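{- Four points $\alpha,\beta,\gamma,\delta\in\widehat{\mathbb{Q}}(\sigma)$ are the vertices of one fundamental tetrahedron if and only if they are of the form $$\frac{p}{q},\quad\frac{r}{s},\quad\frac{p+\sigma^i r}{q+\sigma^i s},\quad\frac{p+\sigma^{i+1}r}{q+\sigma^{i+1}s}$$ for some $p,q,r,s\in\mathbb{Z}[\sigma]$ such that $p/q$ and $r/s$ are irreducible fractions with $l\left(\frac{p}{q},\frac{r}{s}\right)=1$, and some $i\in\mathbb{Z}$ (considered modulo $6$).
   Context: Let $\sigma=e^{i\pi/3}=\frac{1+i\sqrt3}{2}$, $\mathbb{Z}[\sigma]$ the Eisenstein integers, $\mathbb{Q}(\sigma)$ its fraction field and $\widehat{\mathbb{Q}}(\sigma)=\mathbb{Q}(\sigma)\cup\{\infty\}$. In the upper half-space model of $\mathbb{H}^3$ (boundary $\widehat{\mathbb{C}}$), let $T$ be the regular ideal tetrahedron with vertices $0,1,\sigma,\infty$ and $H$ the group generated by reflections in the faces of $T$; the images $hT$, $h\in H$, are the fundamental tetrahedra; they tile $\mathbb{H}^3$ and their vertex set is $\widehat{\mathbb{Q}}(\sigma)$. A fraction $p/q$ ($p,q\in\mathbb{Z}[\sigma]$, not both zero, $p/0=\infty$) is irreducible if every common factor $k\in\mathbb{Z}[\sigma]$ of $p,q$ has $|k|=1$. For irreducible fractions, $l(p_1/q_1,p_2/q_2)=|p_1q_2-p_2q_1|$. -}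

module Defs where

open import Data.Nat using (ℕ; zero; suc)
open import Data.Integer as ℤ using (ℤ; +_)
open import Data.Integer.DivMod using (_%ℕ_)
open import Data.Rational as ℚ using (ℚ; 0ℚ; 1ℚ; _≟_; 1/_; ≢-nonZero)
open import Data.Maybe using (Maybe; just; nothing)
open import Data.Fin using (Fin; zero; suc)
open import Data.List using (List; []; _∷_; foldr)
open import Data.Product using (Σ; _×_)
open import Relation.Binary.PropositionalEquality using (_≡_)
open import Relation.Nullary using (¬_; yes; no)
open import Data.Bool using (true; false)
open import Relation.Nullary.Decidable using (_×-dec_)

-- Eisenstein integers ℤ[σ], σ = e^{iπ/3}, σ² = σ - 1.
-- An element  a + b σ  is represented by the pair (a , b).

record ℤσ : Set where
  constructor _+_σ
  field
    re : ℤ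
    im : ℤ
open ℤσ public

infixl 6 _+ℤσ_ _-ℤσ_
infixl 7 _*ℤσ_

_+ℤσ_ : ℤσ → ℤσ → ℤσ
(a + b σ) +ℤσ (c + d σ) = (a ℤ.+ c) + (b ℤ.+ d) σ

_-ℤσ_ : ℤσ → ℤσ → ℤσ
(a + b σ) -ℤσ (c + d σ) = (a ℤ.- c) + (b ℤ.- d) σ

-- (a + bσ)(c + dσ) = (ac - bd) + (ad + bc + bd)σ   since σ² = σ - 1
_*ℤσ_ : ℤσ → ℤσ → ℤσ
(a + b σ) *ℤσ (c + d σ) = (a ℤ.* c ℤ.- b ℤ.* d) + (a ℤ.* d ℤ.+ b ℤ.* c ℤ.+ b ℤ.* d) σ

0ℤσ 1ℤσ σℤ : ℤσ
0ℤσ = (+ 0) + (+ 0) σ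
1ℤσ = (+ 1) + (+ 0) σ
σℤ  = (+ 0) + (+ 1) σ

∣_∣² : ℤσ → ℤ
∣ a + b σ ∣² = a ℤ.* a ℤ.+ a ℤ.* b ℤ.+ b ℤ.* b

σ^ℕ : ℕ → ℤσ
σ^ℕ zero    = 1ℤσ
σ^ℕ (suc n) = σℤ *ℤσ σ^ℕ n

-- σ^i for i : ℤ; since σ⁶ = 1, σ^i = σ^(i mod 6)
σ^ : ℤ → ℤσ
σ^ i = σ^ℕ (i %ℕ 6)

_∣σ_ : ℤσ → ℤσ → Set
k ∣σ p = Σ ℤσ (λ m → p ≡ k *ℤσ m)

Irreducible : ℤσ → ℤσ → Set
Irreducible p q = ¬ (p ≡ 0ℤσ × q ≡ 0ℤσ)
                × ((k : ℤσ) → k ∣σ p → k ∣σ q → ∣ k ∣² ≡ + 1)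

-- l(p₁/q₁ , p₂/q₂) = |p₁ q₂ - p₂ q₁|; we state l = 1 as |·|² = 1.
l²-is-one : ℤσ → ℤσ → ℤσ → ℤσ → Set
l²-is-one p₁ q₁ p₂ q₂ = ∣ p₁ *ℤσ q₂ -ℤσ p₂ *ℤσ q₁ ∣² ≡ + 1

record ℚσ : Set where
  constructor _+_σ'
  field
    a : ℚ
    b : ℚ
open ℚσ public

_+Q_ _-Q_ _*Q_ : ℚσ → ℚσ → ℚσ
(a + b σ') +Q (c + d σ') = (a ℚ.+ c) + (b ℚ.+ d) σ'
(a + b σ') -Q (c + d σ') = (a ℚ.- c) + (b ℚ.- d) σ'
(a + b σ') *Q (c + d σ') = (a ℚ.* c ℚ.- b ℚ.* d) + (a ℚ.* d ℚ.+ b ℚ.* c ℚ.+ b ℚ.* d) σ'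

-- complex conjugation: conj σ = 1 - σ
conj : ℚσ → ℚσ
conj (a + b σ') = (a ℚ.+ b) + (ℚ.- b) σ'

normQ : ℚσ → ℚ
normQ (a + b σ') = a ℚ.* a ℚ.+ a ℚ.* b ℚ.+ b ℚ.* b

_·Q_ : ℚ → ℚσ → ℚσ
t ·Q (a + b σ') = (t ℚ.* a) + (t ℚ.* b) σ'

-- multiplicative inverse (z⁻¹ = conj z / |z|²); only used at z ≠ 0
invQ : ℚσ → ℚσ
invQ z with normQ z ≟ 0ℚ
... | yes _ = 0ℚ + 0ℚ σ'
... | no n≢0 = (1/_ (normQ z) {{≢-nonZero n≢0}}) ·Q conj z

isZeroQ : ℚσ → Set
isZeroQ z = z ≡ (0ℚ + 0ℚ σ')

embed : ℤσ → ℚσ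
embed (a + b σ) = (a ℚ./ 1) + (b ℚ./ 1) σ'

-- The boundary points  ℚ̂(σ) = ℚ(σ) ∪ {∞};  nothing = ∞.

Point : Set
Point = Maybe ℚσ

∞ : Point
∞ = nothing

-- the point p/q  (p/0 = ∞)
frac : ℤσ → ℤσ → Point
frac p q with (re q ℤ.≟ + 0) ×-dec (im q ℤ.≟ + 0)
... | yes _ = ∞
... | no _  = just (embed p *Q invQ (embed q))

-- Vertices of T: 0, 1, σ, ∞.

0Q 1Q σQ : ℚσ
0Q = 0ℚ + 0ℚ σ'
1Q = 1ℚ + 0ℚ σ'
σQ = 0ℚ + 1ℚ σ'

-- σ² = σ - 1,  σ⁴ = -σ
σ²Q σ⁴Q : ℚσ
σ²Q = (ℚ.- 1ℚ) + 1ℚ σ'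
σ⁴Q = 0ℚ + (ℚ.- 1ℚ) σ'

-- circumcentre of 0, 1, σ:  c = (1 + σ)/3, with |c|² = 1/3
cQ : ℚσ
cQ = ((+ 1) ℚ./ 3) + ((+ 1) ℚ./ 3) σ'

-- The reflections in the four faces of T, described by their action on
-- the sphere at infinity (an isometry of ℍ³ is determined by it).

-- face 0,1,∞ : vertical plane over ℝ      : z ↦ z̄
refl₁ : Point → Point
refl₁ nothing  = nothing
refl₁ (just z) = just (conj z)

-- face 0,σ,∞ : vertical plane over line 0σ : z ↦ σ² z̄
refl₂ : Point → Point
refl₂ nothing  = nothing
refl₂ (just z) = just (σ²Q *Q conj z)

-- face 1,σ,∞ : vertical plane over line 1σ : z ↦ 1 + σ⁴ (z̄ - 1)
refl₃ : Point → Point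
refl₃ nothing  = nothing
refl₃ (just z) = just (1Q +Q (σ⁴Q *Q (conj z -Q 1Q)))

-- face 0,1,σ : hemisphere centred at c of radius 1/√3 :
--   z ↦ c + (1/3) / (z̄ - c̄),   c ↦ ∞,  ∞ ↦ c
refl₄ : Point → Point
refl₄ nothing = just cQ
refl₄ (just z) with (a (conj z -Q conj cQ) ≟ 0ℚ) ×-dec (b (conj z -Q conj cQ) ≟ 0ℚ)
... | yes _ = nothing
... | no _  = just (cQ +Q (((+ 1) ℚ./ 3) ·Q invQ (conj z -Q conj cQ)))

reflection : Fin 4 → Point → Point
reflection zero                   = refl₁
reflection (suc zero)             = refl₂
reflection (suc (suc zero))       = refl₃
reflection (suc (suc (suc zero))) = refl₄

-- Elements of H = ⟨reflections in the faces of T⟩, as words in the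
-- generators, acting on ℚ̂(σ).
Word : Set
Word = List (Fin 4)

act : Word → Point → Point
act w x = foldr reflection x w

-- the vertices of the fundamental tetrahedron hT
vertices : Word → List Point
vertices h = act h (just 0Q) ∷ act h (just 1Q) ∷ act h (just σQ) ∷ act h ∞ ∷ []

-- Write points of ℚ̂(σ) in homogeneous coordinates v = (p, q) ∈ ℤ[σ]²; then l(p/q, r/s) = 1 says
-- that det (v, w) is a unit, which already forces both fractions to be irreducible.
-- The face reflections of T act on ℚ̂(σ) as z ↦ (a z̄ + b)/(c z̄ + d) with matrices over ℤ[σ] of unit
-- determinant, so they send the four points v, w, v + w, v + σw of a unimodular pair to the four
-- points of another one (σ becomes σ̄ = σ⁻¹, which only swaps the last two). T itself comes from
-- v = (0, 1), w = (1, 0), hence so does every fundamental tetrahedron.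
-- Conversely, z ↦ z + 1, z ↦ 1/z and z ↦ σz map T to fundamental tetrahedra and normalise the
-- reflection group, hence permute the fundamental tetrahedra. As ℤ[σ] is Euclidean, these maps and
-- unit scalings carry (0, 1), (1, 0) to every unimodular pair. Scaling (r, s) by the unit σⁱ turns
-- this pattern into the one in the statement.
module Submission where

open import Defs
open import Data.Integer using (ℤ; _+_; +_)
open import Data.List using (List; []; _∷_)
open import Data.List.Relation.Binary.Permutation.Propositional using (_↭_)
open import Data.Product using (Σ; _×_)
open import Function.Bundles using (_⇔_)

open import Level using (0ℓ)
open import Algebra.Bundles using (CommutativeRing)
open import Algebra.Structures using (IsCommutativeRing)
open import Algebra.Consequences.Propositional using (comm∧distrˡ⇒distrʳ)
import Algebra.Solver.Ring.AlmostCommutativeRing as ACR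
import Algebra.Solver.Ring.Simple as RingSolver
open import Data.Bool using (Bool; true; false; _xor_)
open import Data.Fin using (Fin; zero; suc)
open import Data.Integer as ℤ using (_-_; _*_; -[1+_])
import Data.Integer.Properties as ℤP
open import Data.Integer.DivMod using (_%ℕ_; _/ℕ_; a≡a%ℕn+[a/ℕn]*n; n%ℕd<d)
open import Data.Integer.Tactic.RingSolver using () renaming (ring to ℤ-ring)
open import Data.List using (_++_; map)
open import Data.List.Properties using (foldr-++; map-cong; map-cong-local; map-∘)
open import Data.List.Relation.Binary.Permutation.Propositional
  using (↭-refl; ↭-prep; ↭-swap; ↭-trans; ↭-sym; ↭-reflexive; module PermutationReasoning)
open import Data.List.Relation.Binary.Permutation.Propositional.Properties using (map⁺; shift)
open import Data.List.Relation.Unary.All as All using (All; []; _∷_)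
open import Data.Maybe as Maybe using (just; nothing)
open import Data.Nat as ℕ using (ℕ; zero; suc; z≤n)
import Data.Nat.Properties as ℕP
open import Data.Nat.DivMod using (_%_; _/_; m≡m%n+[m/n]*n; m%n<n)
open import Data.Nat.Induction using (<-wellFounded)
open import Data.Product using (_,_; proj₁; proj₂)
open import Data.Rational as ℚ using (0ℚ; 1ℚ; 1/_)
import Data.Rational.Properties as ℚP
open import Data.Rational.Unnormalised as ℚᵘ using (mkℚᵘ; *≡*)
import Data.Rational.Unnormalised.Properties as ℚᵘP
open import Data.Sum using (_⊎_; inj₁; inj₂; [_,_]′)
open import Function using (_∘_; id)
open import Function.Bundles using (mk⇔)
open import Induction.WellFounded using (Acc; acc)
open import Relation.Binary.Definitions using (DecidableEquality)
open import Relation.Binary.PropositionalEquality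
open import Relation.Nullary using (yes; no; contradiction)
open import Relation.Nullary.Decidable using (_×-dec_; from-yes; dec⇒maybe)
import Tactic.RingSolver.Core.AlmostCommutativeRing as TacticACR
open import Tactic.RingSolver using (solve-∀)

-- The ring ℤ[σ]

negℤσ : ℤσ → ℤσ
negℤσ (a + b σ) = (ℤ.- a) + (ℤ.- b) σ

+ℤσ-assoc : ∀ x y z → (x +ℤσ y) +ℤσ z ≡ x +ℤσ (y +ℤσ z)
+ℤσ-assoc (a + b σ) (c + d σ) (e + f σ) = cong₂ _+_σ (ℤP.+-assoc a c e) (ℤP.+-assoc b d f)

+ℤσ-comm : ∀ x y → x +ℤσ y ≡ y +ℤσ x
+ℤσ-comm (a + b σ) (c + d σ) = cong₂ _+_σ (ℤP.+-comm a c) (ℤP.+-comm b d)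

+ℤσ-identityˡ : ∀ x → 0ℤσ +ℤσ x ≡ x
+ℤσ-identityˡ (a + b σ) = cong₂ _+_σ (ℤP.+-identityˡ a) (ℤP.+-identityˡ b)

+ℤσ-inverseˡ : ∀ x → negℤσ x +ℤσ x ≡ 0ℤσ
+ℤσ-inverseˡ (a + b σ) = cong₂ _+_σ (ℤP.+-inverseˡ a) (ℤP.+-inverseˡ b)

*ℤσ-assoc : ∀ x y z → (x *ℤσ y) *ℤσ z ≡ x *ℤσ (y *ℤσ z)
*ℤσ-assoc (a + b σ) (c + d σ) (e + f σ) = cong₂ _+_σ (re-assoc a b c d e f) (im-assoc a b c d e f)
  where
  re-assoc : ∀ a b c d e f → (a * c - b * d) * e - (a * d + b * c + b * d) * f
                           ≡ a * (c * e - d * f) - b * (c * f + d * e + d * f)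
  re-assoc = solve-∀ ℤ-ring
  im-assoc : ∀ a b c d e f → (a * c - b * d) * f + (a * d + b * c + b * d) * e + (a * d + b * c + b * d) * f
                           ≡ a * (c * f + d * e + d * f) + b * (c * e - d * f) + b * (c * f + d * e + d * f)
  im-assoc = solve-∀ ℤ-ring

*ℤσ-comm : ∀ x y → x *ℤσ y ≡ y *ℤσ x
*ℤσ-comm (a + b σ) (c + d σ) = cong₂ _+_σ (re-comm a b c d) (im-comm a b c d)
  where
  re-comm : ∀ a b c d → a * c - b * d ≡ c * a - d * b
  re-comm = solve-∀ ℤ-ring
  im-comm : ∀ a b c d → a * d + b * c + b * d ≡ c * b + d * a + d * b
  im-comm = solve-∀ ℤ-ring

*ℤσ-identityˡ : ∀ x → 1ℤσ *ℤσ x ≡ x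
*ℤσ-identityˡ (a + b σ) = cong₂ _+_σ (re-identity a b) (im-identity a b)
  where
  re-identity : ∀ a b → + 1 * a - + 0 * b ≡ a
  re-identity = solve-∀ ℤ-ring
  im-identity : ∀ a b → + 1 * b + + 0 * a + + 0 * b ≡ b
  im-identity = solve-∀ ℤ-ring

*ℤσ-distribˡ-+ℤσ : ∀ x y z → x *ℤσ (y +ℤσ z) ≡ x *ℤσ y +ℤσ x *ℤσ z
*ℤσ-distribˡ-+ℤσ (a + b σ) (c + d σ) (e + f σ) = cong₂ _+_σ (re-distrib a b c d e f) (im-distrib a b c d e f)
  where
  re-distrib : ∀ a b c d e f → a * (c + e) - b * (d + f) ≡ (a * c - b * d) + (a * e - b * f)
  re-distrib = solve-∀ ℤ-ring
  im-distrib : ∀ a b c d e f → a * (d + f) + b * (c + e) + b * (d + f)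
                             ≡ (a * d + b * c + b * d) + (a * f + b * e + b * f)
  im-distrib = solve-∀ ℤ-ring

ℤσ-isCommutativeRing : IsCommutativeRing _≡_ _+ℤσ_ _*ℤσ_ negℤσ 0ℤσ 1ℤσ
ℤσ-isCommutativeRing = record
  { isRing = record
    { +-isAbelianGroup = record
      { isGroup = record
        { isMonoid = record
          { isSemigroup = record
            { isMagma = record { isEquivalence = isEquivalence ; ∙-cong = cong₂ _+ℤσ_ }
            ; assoc   = +ℤσ-assoc
            }
          ; identity = +ℤσ-identityˡ , λ x → trans (+ℤσ-comm x 0ℤσ) (+ℤσ-identityˡ x)
          }
        ; inverse = +ℤσ-inverseˡ , λ x → trans (+ℤσ-comm x (negℤσ x)) (+ℤσ-inverseˡ x)
        ; ⁻¹-cong = cong negℤσ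
        }
      ; comm = +ℤσ-comm
      }
    ; *-cong     = cong₂ _*ℤσ_
    ; *-assoc    = *ℤσ-assoc
    ; *-identity = *ℤσ-identityˡ , λ x → trans (*ℤσ-comm x 1ℤσ) (*ℤσ-identityˡ x)
    ; distrib    = *ℤσ-distribˡ-+ℤσ , comm∧distrˡ⇒distrʳ *ℤσ-comm *ℤσ-distribˡ-+ℤσ
    }
  ; *-comm = *ℤσ-comm
  }

ℤσ-commutativeRing : CommutativeRing 0ℓ 0ℓ
ℤσ-commutativeRing = record { isCommutativeRing = ℤσ-isCommutativeRing }

_≟ℤσ_ : DecidableEquality ℤσ
(a + b σ) ≟ℤσ (c + d σ) with a ℤ.≟ c | b ℤ.≟ d
... | yes refl | yes refl = yes refl
... | no a≢c   | _        = no λ eq → a≢c (cong re eq)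
... | _        | no b≢d   = no λ eq → b≢d (cong im eq)

module ℤσ-Solver = RingSolver (ACR.fromCommutativeRing ℤσ-commutativeRing) _≟ℤσ_

open CommutativeRing ℤσ-commutativeRing public
  using () renaming (*-identityʳ to *ℤσ-identityʳ; zeroˡ to *ℤσ-zeroˡ; zeroʳ to *ℤσ-zeroʳ)

-- Complex conjugation fixes ℤ and sends σ to 1 - σ.
conjℤσ : ℤσ → ℤσ
conjℤσ (a + b σ) = (a + b) + (ℤ.- b) σ

conjℤσ-+ : ∀ x y → conjℤσ (x +ℤσ y) ≡ conjℤσ x +ℤσ conjℤσ y
conjℤσ-+ (a + b σ) (c + d σ) = cong₂ _+_σ (re-+ a b c d) (ℤP.neg-distrib-+ b d)
  where
  re-+ : ∀ a b c d → (a + c) + (b + d) ≡ (a + b) + (c + d)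
  re-+ = solve-∀ ℤ-ring

conjℤσ-- : ∀ x y → conjℤσ (x -ℤσ y) ≡ conjℤσ x -ℤσ conjℤσ y
conjℤσ-- (a + b σ) (c + d σ) = cong₂ _+_σ (re-- a b c d) (im-- b d)
  where
  re-- : ∀ a b c d → (a - c) + (b - d) ≡ (a + b) - (c + d)
  re-- = solve-∀ ℤ-ring
  im-- : ∀ b d → ℤ.- (b - d) ≡ (ℤ.- b) - (ℤ.- d)
  im-- = solve-∀ ℤ-ring

conjℤσ-* : ∀ x y → conjℤσ (x *ℤσ y) ≡ conjℤσ x *ℤσ conjℤσ y
conjℤσ-* (a + b σ) (c + d σ) = cong₂ _+_σ (re-* a b c d) (im-* a b c d)
  where
  re-* : ∀ a b c d → (a * c - b * d) + (a * d + b * c + b * d) ≡ (a + b) * (c + d) - (ℤ.- b) * (ℤ.- d)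
  re-* = solve-∀ ℤ-ring
  im-* : ∀ a b c d → ℤ.- (a * d + b * c + b * d) ≡ (a + b) * (ℤ.- d) + (ℤ.- b) * (c + d) + (ℤ.- b) * (ℤ.- d)
  im-* = solve-∀ ℤ-ring

conjℤσ-involutive : ∀ x → conjℤσ (conjℤσ x) ≡ x
conjℤσ-involutive (a + b σ) = cong₂ _+_σ (re-involutive a b) (ℤP.neg-involutive b)
  where
  re-involutive : ∀ a b → (a + b) + ℤ.- b ≡ a
  re-involutive = solve-∀ ℤ-ring

*-conjℤσ : ∀ x → x *ℤσ conjℤσ x ≡ ∣ x ∣² + (+ 0) σ
*-conjℤσ (a + b σ) = cong₂ _+_σ (re-norm a b) (im-norm a b)
  where
  re-norm : ∀ a b → a * (a + b) - b * (ℤ.- b) ≡ a * a + a * b + b * b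
  re-norm = solve-∀ ℤ-ring
  im-norm : ∀ a b → a * (ℤ.- b) + b * (a + b) + b * (ℤ.- b) ≡ + 0
  im-norm = solve-∀ ℤ-ring

norm-* : ∀ x y → ∣ x *ℤσ y ∣² ≡ ∣ x ∣² * ∣ y ∣²
norm-* (a + b σ) (c + d σ) = multiplicative a b c d
  where
  multiplicative : ∀ a b c d →
    (a * c - b * d) * (a * c - b * d) + (a * c - b * d) * (a * d + b * c + b * d)
      + (a * d + b * c + b * d) * (a * d + b * c + b * d)
    ≡ (a * a + a * b + b * b) * (c * c + c * d + d * d)
  multiplicative = solve-∀ ℤ-ring

norm-conj : ∀ x → ∣ conjℤσ x ∣² ≡ ∣ x ∣²
norm-conj (a + b σ) = invariant a b
  where
  invariant : ∀ a b → (a + b) * (a + b) + (a + b) * (ℤ.- b) + (ℤ.- b) * (ℤ.- b) ≡ a * a + a * b + b * b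
  invariant = solve-∀ ℤ-ring

norm-swap : ∀ a b → ∣ a + b σ ∣² ≡ ∣ b + a σ ∣²
norm-swap a b = symmetric a b
  where
  symmetric : ∀ a b → a * a + a * b + b * b ≡ b * b + b * a + a * a
  symmetric = solve-∀ ℤ-ring

private
  x*x≡+∣x∣*∣x∣ : ∀ x → x * x ≡ + (ℤ.∣ x ∣ ℕ.* ℤ.∣ x ∣)
  x*x≡+∣x∣*∣x∣ (+ n)    = ℤP.+◃n≡+n (n ℕ.* n)
  x*x≡+∣x∣*∣x∣ -[1+ n ] = ℤP.+◃n≡+n (suc n ℕ.* suc n)

  ∣x∣*∣x∣≡0⇒x≡0 : ∀ x → ℤ.∣ x ∣ ℕ.* ℤ.∣ x ∣ ≡ 0 → x ≡ + 0
  ∣x∣*∣x∣≡0⇒x≡0 x eq = [ ℤP.∣i∣≡0⇒i≡0 , ℤP.∣i∣≡0⇒i≡0 ]′ (ℕP.m*n≡0⇒m≡0∨n≡0 ℤ.∣ x ∣ eq)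

4*norm≡ : ∀ a b → + 4 * ∣ a + b σ ∣²
                ≡ + (ℤ.∣ + 2 * a + b ∣ ℕ.* ℤ.∣ + 2 * a + b ∣ ℕ.+ 3 ℕ.* (ℤ.∣ b ∣ ℕ.* ℤ.∣ b ∣))
4*norm≡ a b = begin
  + 4 * (a * a + a * b + b * b)                   ≡⟨ complete-square a b ⟩
  (+ 2 * a + b) * (+ 2 * a + b) + + 3 * (b * b)   ≡⟨ cong₂ (λ m n → m + + 3 * n) (x*x≡+∣x∣*∣x∣ (+ 2 * a + b)) (x*x≡+∣x∣*∣x∣ b) ⟩
  + A + + 3 * + B                                 ≡⟨ cong (λ n → + A + n) (ℤP.+◃n≡+n (3 ℕ.* B)) ⟩
  + (A ℕ.+ 3 ℕ.* B)                               ∎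
  where
  open ≡-Reasoning
  A = ℤ.∣ + 2 * a + b ∣ ℕ.* ℤ.∣ + 2 * a + b ∣
  B = ℤ.∣ b ∣ ℕ.* ℤ.∣ b ∣
  complete-square : ∀ a b → + 4 * (a * a + a * b + b * b) ≡ (+ 2 * a + b) * (+ 2 * a + b) + + 3 * (b * b)
  complete-square = solve-∀ ℤ-ring

norm-nonneg : ∀ x → + 0 ℤ.≤ ∣ x ∣²
norm-nonneg (a + b σ) = ℤP.*-cancelˡ-≤-pos (+ 0) ∣ a + b σ ∣² (+ 4)
  (subst (+ 0 ℤ.≤_) (sym (4*norm≡ a b)) (ℤ.+≤+ z≤n))

normℕ : ℤσ → ℕ
normℕ x = ℤ.∣ ∣ x ∣² ∣

+normℕ≡norm : ∀ x → + normℕ x ≡ ∣ x ∣²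
+normℕ≡norm x = ℤP.0≤i⇒+∣i∣≡i (norm-nonneg x)

normℕ-* : ∀ x y → normℕ (x *ℤσ y) ≡ normℕ x ℕ.* normℕ y
normℕ-* x y = trans (cong ℤ.∣_∣ (norm-* x y)) (ℤP.abs-* ∣ x ∣² ∣ y ∣²)

normℕ-conj : ∀ x → normℕ (conjℤσ x) ≡ normℕ x
normℕ-conj x = cong ℤ.∣_∣ (norm-conj x)

norm≡0⇒≡0 : ∀ x → ∣ x ∣² ≡ + 0 → x ≡ 0ℤσ
norm≡0⇒≡0 (a + b σ) N≡0 = cong₂ _+_σ a≡0 b≡0
  where
  A = ℤ.∣ + 2 * a + b ∣ ℕ.* ℤ.∣ + 2 * a + b ∣
  B = ℤ.∣ b ∣ ℕ.* ℤ.∣ b ∣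
  A+3B≡0 : A ℕ.+ 3 ℕ.* B ≡ 0
  A+3B≡0 = ℤP.+-injective (trans (sym (4*norm≡ a b)) (cong (+ 4 *_) N≡0))
  b≡0 : b ≡ + 0
  b≡0 = ∣x∣*∣x∣≡0⇒x≡0 b (ℕP.m*n≡0⇒m≡0 B 3 (trans (ℕP.*-comm B 3) (ℕP.m+n≡0⇒n≡0 A A+3B≡0)))
  2a≡0 : + 2 * a ≡ + 0
  2a≡0 = trans (sym (ℤP.+-identityʳ (+ 2 * a)))
               (trans (cong (λ z → + 2 * a + z) (sym b≡0)) (∣x∣*∣x∣≡0⇒x≡0 _ (ℕP.m+n≡0⇒m≡0 A A+3B≡0)))
  a≡0 : a ≡ + 0
  a≡0 = ℤP.*-cancelˡ-≡ (+ 2) a (+ 0) 2a≡0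

*ℤσ-≢0 : ∀ x y → x ≢ 0ℤσ → y ≢ 0ℤσ → x *ℤσ y ≢ 0ℤσ
*ℤσ-≢0 x y x≢0 y≢0 xy≡0 = [ x≢0 ∘ norm≡0⇒≡0 x , y≢0 ∘ norm≡0⇒≡0 y ]′
  (ℤP.i*j≡0⇒i≡0∨j≡0 ∣ x ∣² (trans (sym (norm-* x y)) (cong ∣_∣² xy≡0)))

-- The units of ℤ[σ] are exactly its elements of norm one.
IsUnit : ℤσ → Set
IsUnit x = ∣ x ∣² ≡ + 1

IsUnit-* : ∀ x y → IsUnit x → IsUnit y → IsUnit (x *ℤσ y)
IsUnit-* x y ux uy = trans (norm-* x y) (cong₂ _*_ ux uy)

IsUnit-conj : ∀ x → IsUnit x → IsUnit (conjℤσ x)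
IsUnit-conj x ux = trans (norm-conj x) ux

IsUnit⇒≢0 : ∀ x → IsUnit x → x ≢ 0ℤσ
IsUnit⇒≢0 x ux refl with ux
... | ()

IsUnit-*⁻ : ∀ x y → IsUnit (x *ℤσ y) → IsUnit x × IsUnit y
IsUnit-*⁻ x y uxy = normℕ≡1⇒IsUnit x (ℕP.m*n≡1⇒m≡1 (normℕ x) (normℕ y) Nx*Ny≡1)
                  , normℕ≡1⇒IsUnit y (ℕP.m*n≡1⇒n≡1 (normℕ x) (normℕ y) Nx*Ny≡1)
  where
  Nx*Ny≡1 : normℕ x ℕ.* normℕ y ≡ 1
  Nx*Ny≡1 = trans (sym (normℕ-* x y)) (cong ℤ.∣_∣ uxy)
  normℕ≡1⇒IsUnit : ∀ z → normℕ z ≡ 1 → IsUnit z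
  normℕ≡1⇒IsUnit z Nz≡1 = trans (sym (+normℕ≡norm z)) (cong +_ Nz≡1)

IsUnit⇒*-conj≡1 : ∀ x → IsUnit x → x *ℤσ conjℤσ x ≡ 1ℤσ
IsUnit⇒*-conj≡1 x ux = trans (*-conjℤσ x) (cong (_+ (+ 0) σ) ux)

private
  ∣x∣≤1-cases : ∀ x → ℤ.∣ x ∣ ℕ.≤ 1 → x ≡ + 0 ⊎ x ≡ + 1 ⊎ x ≡ -[1+ 0 ]
  ∣x∣≤1-cases (+ 0)           _               = inj₁ refl
  ∣x∣≤1-cases (+ 1)           _               = inj₂ (inj₁ refl)
  ∣x∣≤1-cases -[1+ 0 ]        _               = inj₂ (inj₂ refl)
  ∣x∣≤1-cases (+ suc (suc _)) (ℕ.s≤s ())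
  ∣x∣≤1-cases -[1+ suc _ ]    (ℕ.s≤s ())

  A+3m²≡4⇒m≤1 : ∀ A m → A ℕ.+ 3 ℕ.* (m ℕ.* m) ≡ 4 → m ℕ.≤ 1
  A+3m²≡4⇒m≤1 A m eq with m ℕ.≤? 1
  ... | yes m≤1 = m≤1
  ... | no  m≰1 = contradiction 12≤4 (ℕP.<⇒≱ (from-yes (4 ℕ.<? 12)))
    where
    2≤m : 2 ℕ.≤ m
    2≤m = ℕP.≰⇒> m≰1
    12≤4 : 12 ℕ.≤ 4
    12≤4 = ℕP.≤-trans (ℕP.*-monoʳ-≤ 3 (ℕP.*-mono-≤ 2≤m 2≤m)) (ℕP.≤-trans (ℕP.m≤n+m _ A) (ℕP.≤-reflexive eq))

  IsUnit⇒∣im∣≤1 : ∀ a b → IsUnit (a + b σ) → ℤ.∣ b ∣ ℕ.≤ 1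
  IsUnit⇒∣im∣≤1 a b u = A+3m²≡4⇒m≤1 (ℤ.∣ + 2 * a + b ∣ ℕ.* ℤ.∣ + 2 * a + b ∣) ℤ.∣ b ∣
    (ℤP.+-injective (trans (sym (4*norm≡ a b)) (cong (+ 4 *_) u)))

IsUnit⇒σ^ℕ : ∀ e → IsUnit e → Σ ℕ λ k → e ≡ σ^ℕ k
IsUnit⇒σ^ℕ (a + b σ) u = classify (∣x∣≤1-cases a ∣a∣≤1) (∣x∣≤1-cases b ∣b∣≤1) u
  where
  ∣a∣≤1 = IsUnit⇒∣im∣≤1 b a (trans (sym (norm-swap a b)) u)
  ∣b∣≤1 = IsUnit⇒∣im∣≤1 a b u
  classify : a ≡ + 0 ⊎ a ≡ + 1 ⊎ a ≡ -[1+ 0 ] → b ≡ + 0 ⊎ b ≡ + 1 ⊎ b ≡ -[1+ 0 ] →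
             IsUnit (a + b σ) → Σ ℕ λ k → a + b σ ≡ σ^ℕ k
  classify (inj₁ refl)        (inj₁ refl)        ()
  classify (inj₁ refl)        (inj₂ (inj₁ refl)) _  = 1 , refl
  classify (inj₁ refl)        (inj₂ (inj₂ refl)) _  = 4 , refl
  classify (inj₂ (inj₁ refl)) (inj₁ refl)        _  = 0 , refl
  classify (inj₂ (inj₁ refl)) (inj₂ (inj₁ refl)) ()
  classify (inj₂ (inj₁ refl)) (inj₂ (inj₂ refl)) _  = 5 , refl
  classify (inj₂ (inj₂ refl)) (inj₁ refl)        _  = 3 , refl
  classify (inj₂ (inj₂ refl)) (inj₂ (inj₁ refl)) _  = 2 , refl
  classify (inj₂ (inj₂ refl)) (inj₂ (inj₂ refl)) ()

σ^ℕ-+ : ∀ m n → σ^ℕ (m ℕ.+ n) ≡ σ^ℕ m *ℤσ σ^ℕ n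
σ^ℕ-+ zero    n = sym (*ℤσ-identityˡ (σ^ℕ n))
σ^ℕ-+ (suc m) n = trans (cong (σℤ *ℤσ_) (σ^ℕ-+ m n)) (sym (*ℤσ-assoc σℤ (σ^ℕ m) (σ^ℕ n)))

σ^ℕ-periodic : ∀ n → σ^ℕ (n % 6) ≡ σ^ℕ n
σ^ℕ-periodic n = sym (begin
  σ^ℕ n                                ≡⟨ cong σ^ℕ (m≡m%n+[m/n]*n n 6) ⟩
  σ^ℕ (n % 6 ℕ.+ (n / 6) ℕ.* 6)        ≡⟨ σ^ℕ-+ (n % 6) ((n / 6) ℕ.* 6) ⟩
  σ^ℕ (n % 6) *ℤσ σ^ℕ ((n / 6) ℕ.* 6)  ≡⟨ cong (σ^ℕ (n % 6) *ℤσ_) (σ^ℕ[k*6]≡1 (n / 6)) ⟩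
  σ^ℕ (n % 6) *ℤσ 1ℤσ                  ≡⟨ *ℤσ-identityʳ (σ^ℕ (n % 6)) ⟩
  σ^ℕ (n % 6)                          ∎)
  where
  open ≡-Reasoning
  σ^ℕ[k*6]≡1 : ∀ k → σ^ℕ (k ℕ.* 6) ≡ 1ℤσ
  σ^ℕ[k*6]≡1 zero    = refl
  σ^ℕ[k*6]≡1 (suc k) = trans (σ^ℕ-+ 6 (k ℕ.* 6)) (cong (σ^ℕ 6 *ℤσ_) (σ^ℕ[k*6]≡1 k))

IsUnit-σ^ℕ : ∀ n → IsUnit (σ^ℕ n)
IsUnit-σ^ℕ zero    = refl
IsUnit-σ^ℕ (suc n) = IsUnit-* σℤ (σ^ℕ n) refl (IsUnit-σ^ℕ n)

IsUnit-σ^ : ∀ i → IsUnit (σ^ i)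
IsUnit-σ^ i = IsUnit-σ^ℕ (i %ℕ 6)

private
  inverse-unique : ∀ x y u → x *ℤσ u ≡ 1ℤσ → y *ℤσ u ≡ 1ℤσ → x ≡ y
  inverse-unique x y u xu≡1 yu≡1 = begin
    x                ≡⟨ *ℤσ-identityʳ x ⟨
    x *ℤσ 1ℤσ        ≡⟨ cong (x *ℤσ_) yu≡1 ⟨
    x *ℤσ (y *ℤσ u)  ≡⟨ solve 3 (λ x y u → x :* (y :* u) := (x :* u) :* y) refl x y u ⟩
    (x *ℤσ u) *ℤσ y  ≡⟨ cong (_*ℤσ y) xu≡1 ⟩
    1ℤσ *ℤσ y        ≡⟨ *ℤσ-identityˡ y ⟩
    y                ∎
    where
    open ≡-Reasoning
    open ℤσ-Solver using (solve; _:=_; _:*_)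

  σ^-negsuc-inverse : ∀ n → σ^ -[1+ n ] *ℤσ σ^ℕ (suc n) ≡ 1ℤσ
  σ^-negsuc-inverse n with suc n % 6 in eq
  ... | zero  = trans (*ℤσ-identityˡ (σ^ℕ (suc n))) (trans (sym (σ^ℕ-periodic (suc n))) (cong σ^ℕ eq))
  ... | suc r = begin
    σ^ℕ (6 ℕ.∸ suc r) *ℤσ σ^ℕ (suc n)  ≡⟨ cong (σ^ℕ (6 ℕ.∸ suc r) *ℤσ_) (trans (sym (σ^ℕ-periodic (suc n))) (cong σ^ℕ eq)) ⟩
    σ^ℕ (6 ℕ.∸ suc r) *ℤσ σ^ℕ (suc r)  ≡⟨ σ^ℕ-+ (6 ℕ.∸ suc r) (suc r) ⟨
    σ^ℕ (6 ℕ.∸ suc r ℕ.+ suc r)        ≡⟨ cong σ^ℕ (ℕP.m∸n+n≡m (ℕP.<⇒≤ (subst (ℕ._< 6) eq (m%n<n (suc n) 6)))) ⟩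
    σ^ℕ 6                              ∎
    where open ≡-Reasoning

σ^-suc : ∀ i → σ^ (i + + 1) ≡ σℤ *ℤσ σ^ i
σ^-suc (+ n) = begin
  σ^ℕ ((n ℕ.+ 1) % 6)   ≡⟨ σ^ℕ-periodic (n ℕ.+ 1) ⟩
  σ^ℕ (n ℕ.+ 1)         ≡⟨ cong σ^ℕ (ℕP.+-comm n 1) ⟩
  σℤ *ℤσ σ^ℕ n          ≡⟨ cong (σℤ *ℤσ_) (σ^ℕ-periodic n) ⟨
  σℤ *ℤσ σ^ℕ (n % 6)    ∎
  where open ≡-Reasoning
σ^-suc -[1+ zero ]  = refl
σ^-suc -[1+ suc n ] = inverse-unique (σ^ -[1+ n ]) (σℤ *ℤσ σ^ -[1+ suc n ]) (σ^ℕ (suc n))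
  (σ^-negsuc-inverse n)
  (trans (solve 2 (λ x u → (con σℤ :* x) :* u := x :* (con σℤ :* u)) refl (σ^ -[1+ suc n ]) (σ^ℕ (suc n)))
         (σ^-negsuc-inverse (suc n)))
  where open ℤσ-Solver using (solve; _:=_; _:*_; con)

private
  ∣r⊖n∣≤n : ∀ r n .{{_ : ℕ.NonZero n}} → r ℕ.< n ℕ.+ n → ℤ.∣ r ℤ.⊖ n ∣ ℕ.≤ n
  ∣r⊖n∣≤n r n r<2n with r ℕ.<? n
  ... | yes r<n = ℕP.≤-trans (ℕP.≤-reflexive (ℤP.∣⊖∣-< r<n)) (ℕP.m∸n≤m n r)
  ... | no  r≮n = ℕP.≤-trans (ℕP.≤-reflexive (trans (ℤP.∣m⊖n∣≡∣n⊖m∣ r n) (ℤP.∣⊖∣-≤ (ℕP.≮⇒≥ r≮n))))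
                             (ℕP.<⇒≤ (ℕP.m<n+o⇒m∸n<o r n r<2n))

  i≤+∣i∣ : ∀ i → i ℤ.≤ + ℤ.∣ i ∣
  i≤+∣i∣ (+ n)    = ℤP.≤-refl
  i≤+∣i∣ -[1+ n ] = ℤ.-≤+

-- t is the quotient of 2X + N by 2N, so that 2X + N = r + 2Nt with 0 ≤ r < 2N.
nearest-multiple : ∀ X N .{{_ : ℕ.NonZero N}} → Σ ℤ λ t → ℤ.∣ + 2 * (X - t * + N) ∣ ℕ.≤ N
nearest-multiple X N@(suc _) = t , subst (ℕ._≤ N) (cong ℤ.∣_∣ r⊖N≡2[X-tN]) (∣r⊖n∣≤n r N (n%ℕd<d n (N ℕ.+ N)))
  where
  n = + 2 * X + + N
  r = n %ℕ (N ℕ.+ N)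
  t = n /ℕ (N ℕ.+ N)
  r⊖N≡2[X-tN] : r ℤ.⊖ N ≡ + 2 * (X - t * + N)
  r⊖N≡2[X-tN] = begin
    r ℤ.⊖ N                                          ≡⟨ ℤP.m-n≡m⊖n r N ⟨
    + r - + N                                        ≡⟨ cancel (+ r) t (+ N) ⟩
    (+ r + t * (+ N + + N)) - t * (+ N + + N) - + N  ≡⟨ cong (λ m → m - t * (+ N + + N) - + N) (a≡a%ℕn+[a/ℕn]*n n (N ℕ.+ N)) ⟨
    n - t * (+ N + + N) - + N                        ≡⟨ regroup X t (+ N) ⟩
    + 2 * (X - t * + N)                              ∎
    where
    open ≡-Reasoning
    cancel : ∀ r t N → r - N ≡ (r + t * (N + N)) - t * (N + N) - N
    cancel = solve-∀ ℤ-ring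
    regroup : ∀ X t N → (+ 2 * X + N) - t * (N + N) - N ≡ + 2 * (X - t * N)
    regroup = solve-∀ ℤ-ring

4*norm≤3*square : ∀ x y N → ℤ.∣ + 2 * x ∣ ℕ.≤ N → ℤ.∣ + 2 * y ∣ ℕ.≤ N →
                  4 ℕ.* normℕ (x + y σ) ℕ.≤ 3 ℕ.* (N ℕ.* N)
4*norm≤3*square x y N ∣u∣≤N ∣v∣≤N = ℤP.drop‿+≤+ (begin
  + (4 ℕ.* normℕ (x + y σ))                 ≡⟨ ℤP.+◃n≡+n (4 ℕ.* normℕ (x + y σ)) ⟨
  + 4 * + normℕ (x + y σ)                   ≡⟨ cong (+ 4 *_) (+normℕ≡norm (x + y σ)) ⟩
  + 4 * (x * x + x * y + y * y)             ≡⟨ scale x y ⟩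
  u * u + u * v + v * v                     ≤⟨ ℤP.+-mono-≤ (ℤP.+-mono-≤ (ℤP.≤-reflexive (x*x≡+∣x∣*∣x∣ u)) uv≤UV) (ℤP.≤-reflexive (x*x≡+∣x∣*∣x∣ v)) ⟩
  + (U ℕ.* U ℕ.+ U ℕ.* V ℕ.+ V ℕ.* V)       ≤⟨ ℤ.+≤+ (ℕP.+-mono-≤ (ℕP.+-mono-≤ (ℕP.*-mono-≤ ∣u∣≤N ∣u∣≤N) (ℕP.*-mono-≤ ∣u∣≤N ∣v∣≤N))
                                                                (ℕP.*-mono-≤ ∣v∣≤N ∣v∣≤N)) ⟩
  + (N ℕ.* N ℕ.+ N ℕ.* N ℕ.+ N ℕ.* N)       ≡⟨ cong +_ (three-times (N ℕ.* N)) ⟩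
  + (3 ℕ.* (N ℕ.* N))                       ∎)
  where
  open ℤP.≤-Reasoning
  u = + 2 * x
  v = + 2 * y
  U = ℤ.∣ u ∣
  V = ℤ.∣ v ∣
  scale : ∀ x y → + 4 * (x * x + x * y + y * y) ≡ (+ 2 * x) * (+ 2 * x) + (+ 2 * x) * (+ 2 * y) + (+ 2 * y) * (+ 2 * y)
  scale = solve-∀ ℤ-ring
  uv≤UV : u * v ℤ.≤ + (U ℕ.* V)
  uv≤UV = ℤP.≤-trans (i≤+∣i∣ (u * v)) (ℤP.≤-reflexive (cong +_ (ℤP.abs-* u v)))
  three-times : ∀ m → m ℕ.+ m ℕ.+ m ≡ 3 ℕ.* m
  three-times m = trans (ℕP.+-assoc m m m) (cong (λ k → m ℕ.+ (m ℕ.+ k)) (sym (ℕP.+-identityʳ m)))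

private
  4mn≤3nn⇒m<n : ∀ m n .{{_ : ℕ.NonZero n}} → 4 ℕ.* (m ℕ.* n) ℕ.≤ 3 ℕ.* (n ℕ.* n) → m ℕ.< n
  4mn≤3nn⇒m<n m n@(suc _) 4mn≤3nn = ℕP.≰⇒> λ n≤m →
    ℕP.<⇒≱ (ℕP.*-monoˡ-< (n ℕ.* n) {3} {4} (ℕP.n<1+n 3)) (ℕP.≤-trans (ℕP.*-monoʳ-≤ 4 (ℕP.*-monoˡ-≤ n n≤m)) 4mn≤3nn)

-- With w = a c̄ = X + Yσ and t ≈ w / N(c): (a - tc) c̄ = (X - t₁N) + (Y - t₂N)σ has norm ≤ 3N²/4.
euclidean : ∀ a c → c ≢ 0ℤσ → Σ ℤσ λ t → normℕ (a -ℤσ t *ℤσ c) ℕ.< normℕ c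
euclidean a c c≢0 = t , 4mn≤3nn⇒m<n M N 4MN≤3NN
  where
  N = normℕ c
  instance
    N≢0 : ℕ.NonZero N
    N≢0 = ℕ.≢-nonZero λ N≡0 → c≢0 (norm≡0⇒≡0 c (trans (sym (+normℕ≡norm c)) (cong +_ N≡0)))
  w = a *ℤσ conjℤσ c
  t₁ = proj₁ (nearest-multiple (re w) N)
  t₂ = proj₁ (nearest-multiple (im w) N)
  t = t₁ + t₂ σ
  x = re w - t₁ * + N
  y = im w - t₂ * + N
  M = normℕ (a -ℤσ t *ℤσ c)
  remainder : (a -ℤσ t *ℤσ c) *ℤσ conjℤσ c ≡ x + y σ
  remainder = begin
    (a -ℤσ t *ℤσ c) *ℤσ conjℤσ c  ≡⟨ solve 4 (λ a t c c̄ → (a :- t :* c) :* c̄ := a :* c̄ :- t :* (c :* c̄)) refl a t c (conjℤσ c) ⟩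
    w -ℤσ t *ℤσ (c *ℤσ conjℤσ c)  ≡⟨ cong (λ z → w -ℤσ t *ℤσ z) (trans (*-conjℤσ c) (cong (_+ (+ 0) σ) (sym (+normℕ≡norm c)))) ⟩
    w -ℤσ t *ℤσ ((+ N) + (+ 0) σ) ≡⟨ cong₂ _+_σ (re-remainder (re w) t₁ t₂ (+ N)) (im-remainder (im w) t₁ t₂ (+ N)) ⟩
    x + y σ                       ∎
    where
    open ≡-Reasoning
    open ℤσ-Solver using (solve; _:=_; _:*_; _:-_)
    re-remainder : ∀ X t₁ t₂ N → X - (t₁ * N - t₂ * + 0) ≡ X - t₁ * N
    re-remainder = solve-∀ ℤ-ring
    im-remainder : ∀ Y t₁ t₂ N → Y - (t₁ * + 0 + t₂ * N + t₂ * + 0) ≡ Y - t₂ * N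
    im-remainder = solve-∀ ℤ-ring
  4MN≤3NN : 4 ℕ.* (M ℕ.* N) ℕ.≤ 3 ℕ.* (N ℕ.* N)
  4MN≤3NN = subst (λ k → 4 ℕ.* k ℕ.≤ 3 ℕ.* (N ℕ.* N))
    (trans (cong normℕ (sym remainder)) (trans (normℕ-* (a -ℤσ t *ℤσ c) (conjℤσ c)) (cong (M ℕ.*_) (normℕ-conj c))))
    (4*norm≤3*square x y N (proj₂ (nearest-multiple (re w) N)) (proj₂ (nearest-multiple (im w) N)))

-- The field ℚ(σ)

ℚ-ring : TacticACR.AlmostCommutativeRing 0ℓ 0ℓ
ℚ-ring = TacticACR.fromCommutativeRing ℚP.+-*-commutativeRing (λ x → dec⇒maybe (0ℚ ℚ.≟ x))

negQ : ℚσ → ℚσ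
negQ (a + b σ') = (ℚ.- a) + (ℚ.- b) σ'

+Q-assoc : ∀ x y z → (x +Q y) +Q z ≡ x +Q (y +Q z)
+Q-assoc (a + b σ') (c + d σ') (e + f σ') = cong₂ _+_σ' (ℚP.+-assoc a c e) (ℚP.+-assoc b d f)

+Q-comm : ∀ x y → x +Q y ≡ y +Q x
+Q-comm (a + b σ') (c + d σ') = cong₂ _+_σ' (ℚP.+-comm a c) (ℚP.+-comm b d)

+Q-identityˡ : ∀ x → 0Q +Q x ≡ x
+Q-identityˡ (a + b σ') = cong₂ _+_σ' (ℚP.+-identityˡ a) (ℚP.+-identityˡ b)

+Q-inverseˡ : ∀ x → negQ x +Q x ≡ 0Q
+Q-inverseˡ (a + b σ') = cong₂ _+_σ' (ℚP.+-inverseˡ a) (ℚP.+-inverseˡ b)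

*Q-assoc : ∀ x y z → (x *Q y) *Q z ≡ x *Q (y *Q z)
*Q-assoc (a + b σ') (c + d σ') (e + f σ') = cong₂ _+_σ' (re-assoc a b c d e f) (im-assoc a b c d e f)
  where
  re-assoc : ∀ a b c d e f → (a ℚ.* c ℚ.- b ℚ.* d) ℚ.* e ℚ.- (a ℚ.* d ℚ.+ b ℚ.* c ℚ.+ b ℚ.* d) ℚ.* f
                           ≡ a ℚ.* (c ℚ.* e ℚ.- d ℚ.* f) ℚ.- b ℚ.* (c ℚ.* f ℚ.+ d ℚ.* e ℚ.+ d ℚ.* f)
  re-assoc = solve-∀ ℚ-ring
  im-assoc : ∀ a b c d e f → (a ℚ.* c ℚ.- b ℚ.* d) ℚ.* f ℚ.+ (a ℚ.* d ℚ.+ b ℚ.* c ℚ.+ b ℚ.* d) ℚ.* e ℚ.+ (a ℚ.* d ℚ.+ b ℚ.* c ℚ.+ b ℚ.* d) ℚ.* f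
                           ≡ a ℚ.* (c ℚ.* f ℚ.+ d ℚ.* e ℚ.+ d ℚ.* f) ℚ.+ b ℚ.* (c ℚ.* e ℚ.- d ℚ.* f) ℚ.+ b ℚ.* (c ℚ.* f ℚ.+ d ℚ.* e ℚ.+ d ℚ.* f)
  im-assoc = solve-∀ ℚ-ring

*Q-comm : ∀ x y → x *Q y ≡ y *Q x
*Q-comm (a + b σ') (c + d σ') = cong₂ _+_σ' (re-comm a b c d) (im-comm a b c d)
  where
  re-comm : ∀ a b c d → a ℚ.* c ℚ.- b ℚ.* d ≡ c ℚ.* a ℚ.- d ℚ.* b
  re-comm = solve-∀ ℚ-ring
  im-comm : ∀ a b c d → a ℚ.* d ℚ.+ b ℚ.* c ℚ.+ b ℚ.* d ≡ c ℚ.* b ℚ.+ d ℚ.* a ℚ.+ d ℚ.* b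
  im-comm = solve-∀ ℚ-ring

*Q-identityˡ : ∀ x → 1Q *Q x ≡ x
*Q-identityˡ (a + b σ') = cong₂ _+_σ' (re-identity a b) (im-identity a b)
  where
  re-identity : ∀ a b → 1ℚ ℚ.* a ℚ.- 0ℚ ℚ.* b ≡ a
  re-identity = solve-∀ ℚ-ring
  im-identity : ∀ a b → 1ℚ ℚ.* b ℚ.+ 0ℚ ℚ.* a ℚ.+ 0ℚ ℚ.* b ≡ b
  im-identity = solve-∀ ℚ-ring

*Q-distribˡ-+Q : ∀ x y z → x *Q (y +Q z) ≡ (x *Q y) +Q (x *Q z)
*Q-distribˡ-+Q (a + b σ') (c + d σ') (e + f σ') = cong₂ _+_σ' (re-distrib a b c d e f) (im-distrib a b c d e f)
  where
  re-distrib : ∀ a b c d e f → a ℚ.* (c ℚ.+ e) ℚ.- b ℚ.* (d ℚ.+ f) ≡ (a ℚ.* c ℚ.- b ℚ.* d) ℚ.+ (a ℚ.* e ℚ.- b ℚ.* f)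
  re-distrib = solve-∀ ℚ-ring
  im-distrib : ∀ a b c d e f → a ℚ.* (d ℚ.+ f) ℚ.+ b ℚ.* (c ℚ.+ e) ℚ.+ b ℚ.* (d ℚ.+ f)
                             ≡ (a ℚ.* d ℚ.+ b ℚ.* c ℚ.+ b ℚ.* d) ℚ.+ (a ℚ.* f ℚ.+ b ℚ.* e ℚ.+ b ℚ.* f)
  im-distrib = solve-∀ ℚ-ring

ℚσ-isCommutativeRing : IsCommutativeRing _≡_ _+Q_ _*Q_ negQ 0Q 1Q
ℚσ-isCommutativeRing = record
  { isRing = record
    { +-isAbelianGroup = record
      { isGroup = record
        { isMonoid = record
          { isSemigroup = record
            { isMagma = record { isEquivalence = isEquivalence ; ∙-cong = cong₂ _+Q_ }
            ; assoc   = +Q-assoc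
            }
          ; identity = +Q-identityˡ , λ x → trans (+Q-comm x 0Q) (+Q-identityˡ x)
          }
        ; inverse = +Q-inverseˡ , λ x → trans (+Q-comm x (negQ x)) (+Q-inverseˡ x)
        ; ⁻¹-cong = cong negQ
        }
      ; comm = +Q-comm
      }
    ; *-cong     = cong₂ _*Q_
    ; *-assoc    = *Q-assoc
    ; *-identity = *Q-identityˡ , λ x → trans (*Q-comm x 1Q) (*Q-identityˡ x)
    ; distrib    = *Q-distribˡ-+Q , comm∧distrˡ⇒distrʳ *Q-comm *Q-distribˡ-+Q
    }
  ; *-comm = *Q-comm
  }

ℚσ-commutativeRing : CommutativeRing 0ℓ 0ℓ
ℚσ-commutativeRing = record { isCommutativeRing = ℚσ-isCommutativeRing }

_≟Q_ : DecidableEquality ℚσ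
(a + b σ') ≟Q (c + d σ') with a ℚ.≟ c | b ℚ.≟ d
... | yes refl | yes refl = yes refl
... | no a≢c   | _        = no λ eq → a≢c (cong ℚσ.a eq)
... | _        | no b≢d   = no λ eq → b≢d (cong ℚσ.b eq)

module ℚσ-Solver = RingSolver (ACR.fromCommutativeRing ℚσ-commutativeRing) _≟Q_

open CommutativeRing ℚσ-commutativeRing public
  using () renaming (*-identityʳ to *Q-identityʳ; zeroʳ to *Q-zeroʳ)

conjQ-* : ∀ x y → conj (x *Q y) ≡ conj x *Q conj y
conjQ-* (a + b σ') (c + d σ') = cong₂ _+_σ' (re-* a b c d) (im-* a b c d)
  where
  re-* : ∀ a b c d → (a ℚ.* c ℚ.- b ℚ.* d) ℚ.+ (a ℚ.* d ℚ.+ b ℚ.* c ℚ.+ b ℚ.* d)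
                   ≡ (a ℚ.+ b) ℚ.* (c ℚ.+ d) ℚ.- (ℚ.- b) ℚ.* (ℚ.- d)
  re-* = solve-∀ ℚ-ring
  im-* : ∀ a b c d → ℚ.- (a ℚ.* d ℚ.+ b ℚ.* c ℚ.+ b ℚ.* d)
                   ≡ (a ℚ.+ b) ℚ.* (ℚ.- d) ℚ.+ (ℚ.- b) ℚ.* (c ℚ.+ d) ℚ.+ (ℚ.- b) ℚ.* (ℚ.- d)
  im-* = solve-∀ ℚ-ring

conjQ-involutive : ∀ x → conj (conj x) ≡ x
conjQ-involutive (a + b σ') = cong₂ _+_σ' (re-involutive a b) (im-involutive b)
  where
  re-involutive : ∀ a b → (a ℚ.+ b) ℚ.+ ℚ.- b ≡ a
  re-involutive = solve-∀ ℚ-ring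
  im-involutive : ∀ b → ℚ.- (ℚ.- b) ≡ b
  im-involutive = solve-∀ ℚ-ring

conjQ-≢0 : ∀ x → x ≢ 0Q → conj x ≢ 0Q
conjQ-≢0 x x≢0 x̄≡0 = x≢0 (trans (sym (conjQ-involutive x)) (cong conj x̄≡0))

*Q-conj : ∀ x → x *Q conj x ≡ normQ x + 0ℚ σ'
*Q-conj (a + b σ') = cong₂ _+_σ' (re-norm a b) (im-norm a b)
  where
  re-norm : ∀ a b → a ℚ.* (a ℚ.+ b) ℚ.- b ℚ.* (ℚ.- b) ≡ a ℚ.* a ℚ.+ a ℚ.* b ℚ.+ b ℚ.* b
  re-norm = solve-∀ ℚ-ring
  im-norm : ∀ a b → a ℚ.* (ℚ.- b) ℚ.+ b ℚ.* (a ℚ.+ b) ℚ.+ b ℚ.* (ℚ.- b) ≡ 0ℚ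
  im-norm = solve-∀ ℚ-ring

·Q≡*Q : ∀ t z → t ·Q z ≡ (t + 0ℚ σ') *Q z
·Q≡*Q t (a + b σ') = cong₂ _+_σ' (re-scale t a b) (im-scale t a b)
  where
  re-scale : ∀ t a b → t ℚ.* a ≡ t ℚ.* a ℚ.- 0ℚ ℚ.* b
  re-scale = solve-∀ ℚ-ring
  im-scale : ∀ t a b → t ℚ.* b ≡ t ℚ.* b ℚ.+ 0ℚ ℚ.* a ℚ.+ 0ℚ ℚ.* b
  im-scale = solve-∀ ℚ-ring

private
  0≤p*p : ∀ p → 0ℚ ℚ.≤ p ℚ.* p
  0≤p*p p with ℚP.≤-total 0ℚ p
  ... | inj₁ 0≤p = ℚP.nonNegative⁻¹ (p ℚ.* p)
                     {{ℚP.nonNeg*nonNeg⇒nonNeg p {{ℚ.nonNegative 0≤p}} p {{ℚ.nonNegative 0≤p}}}}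
  ... | inj₂ p≤0 = ℚP.nonNegative⁻¹ (p ℚ.* p)
                     {{ℚP.nonPos*nonPos⇒nonPos p {{ℚ.nonPositive p≤0}} p {{ℚ.nonPositive p≤0}}}}

  nonneg-+-≡0ʳ : ∀ {p q} → 0ℚ ℚ.≤ p → 0ℚ ℚ.≤ q → p ℚ.+ q ≡ 0ℚ → q ≡ 0ℚ
  nonneg-+-≡0ʳ {p} {q} 0≤p 0≤q p+q≡0 =
    ℚP.≤-antisym (subst₂ ℚ._≤_ (ℚP.+-identityˡ q) p+q≡0 (ℚP.+-monoˡ-≤ q 0≤p)) 0≤q

  nonneg-+ : ∀ {p q} → 0ℚ ℚ.≤ p → 0ℚ ℚ.≤ q → 0ℚ ℚ.≤ p ℚ.+ q
  nonneg-+ {p} {q} 0≤p 0≤q = subst (ℚ._≤ p ℚ.+ q) (ℚP.+-identityʳ 0ℚ) (ℚP.+-mono-≤ 0≤p 0≤q)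

  p*p≡0⇒p≡0 : ∀ p → p ℚ.* p ≡ 0ℚ → p ≡ 0ℚ
  p*p≡0⇒p≡0 p p²≡0 with p ℚ.≟ 0ℚ
  ... | yes p≡0 = p≡0
  ... | no  p≢0 = begin
    p                     ≡⟨ ℚP.*-identityʳ p ⟨
    p ℚ.* 1ℚ              ≡⟨ cong (p ℚ.*_) (ℚP.*-inverseʳ p) ⟨
    p ℚ.* (p ℚ.* 1/ p)    ≡⟨ ℚP.*-assoc p p (1/ p) ⟨
    (p ℚ.* p) ℚ.* 1/ p    ≡⟨ cong (ℚ._* 1/ p) p²≡0 ⟩
    0ℚ ℚ.* 1/ p           ≡⟨ ℚP.*-zeroˡ (1/ p) ⟩
    0ℚ                    ∎
    where
    open ≡-Reasoning
    instance _ = ℚ.≢-nonZero p≢0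

-- ℚ(σ) is a field: 4 (a² + ab + b²) = (2a + b)² + 3b² only vanishes at a = b = 0.
normQ≡0⇒≡0 : ∀ x → normQ x ≡ 0ℚ → x ≡ 0Q
normQ≡0⇒≡0 (a + b σ') N≡0 = cong₂ _+_σ' a≡0 b≡0
  where
  b² = b ℚ.* b
  complete-square : ∀ a b → (a ℚ.+ a ℚ.+ b) ℚ.* (a ℚ.+ a ℚ.+ b) ℚ.+ (b ℚ.* b ℚ.+ b ℚ.* b ℚ.+ b ℚ.* b)
    ≡ (a ℚ.* a ℚ.+ a ℚ.* b ℚ.+ b ℚ.* b) ℚ.+ (a ℚ.* a ℚ.+ a ℚ.* b ℚ.+ b ℚ.* b)
      ℚ.+ (a ℚ.* a ℚ.+ a ℚ.* b ℚ.+ b ℚ.* b) ℚ.+ (a ℚ.* a ℚ.+ a ℚ.* b ℚ.+ b ℚ.* b)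
  complete-square = solve-∀ ℚ-ring
  4N≡0 : (a ℚ.+ a ℚ.+ b) ℚ.* (a ℚ.+ a ℚ.+ b) ℚ.+ (b² ℚ.+ b² ℚ.+ b²) ≡ 0ℚ
  4N≡0 = trans (complete-square a b) (cong (λ n → n ℚ.+ n ℚ.+ n ℚ.+ n) N≡0)
  0≤2b² = nonneg-+ (0≤p*p b) (0≤p*p b)
  b≡0 : b ≡ 0ℚ
  b≡0 = p*p≡0⇒p≡0 b (nonneg-+-≡0ʳ 0≤2b² (0≤p*p b)
          (nonneg-+-≡0ʳ (0≤p*p (a ℚ.+ a ℚ.+ b)) (nonneg-+ 0≤2b² (0≤p*p b)) 4N≡0))
  a≡0 : a ≡ 0ℚ
  a≡0 = p*p≡0⇒p≡0 a (trans (sym (drop-zero a)) (trans (cong (λ b → a ℚ.* a ℚ.+ a ℚ.* b ℚ.+ b ℚ.* b) (sym b≡0)) N≡0))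
    where
    drop-zero : ∀ a → a ℚ.* a ℚ.+ a ℚ.* 0ℚ ℚ.+ 0ℚ ℚ.* 0ℚ ≡ a ℚ.* a
    drop-zero = solve-∀ ℚ-ring

private
  invQ≡ : ∀ z (N≢0 : normQ z ≢ 0ℚ) → invQ z ≡ (1/ normQ z) {{ℚ.≢-nonZero N≢0}} ·Q conj z
  invQ≡ z N≢0 with normQ z ℚ.≟ 0ℚ
  ... | yes N≡0 = contradiction N≡0 N≢0
  ... | no  _   = refl

*Q-invQ : ∀ z → z ≢ 0Q → z *Q invQ z ≡ 1Q
*Q-invQ z z≢0 = begin
  z *Q invQ z                        ≡⟨ cong (z *Q_) (trans (invQ≡ z N≢0) (·Q≡*Q t (conj z))) ⟩
  z *Q ((t + 0ℚ σ') *Q conj z)       ≡⟨ solve 3 (λ z t z̄ → z :* (t :* z̄) := t :* (z :* z̄)) refl z (t + 0ℚ σ') (conj z) ⟩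
  (t + 0ℚ σ') *Q (z *Q conj z)       ≡⟨ cong ((t + 0ℚ σ') *Q_) (*Q-conj z) ⟩
  (t + 0ℚ σ') *Q (normQ z + 0ℚ σ')   ≡⟨ cong₂ _+_σ' (re-real t (normQ z)) (im-real t (normQ z)) ⟩
  (t ℚ.* normQ z) + 0ℚ σ'            ≡⟨ cong (_+ 0ℚ σ') (ℚP.*-inverseˡ (normQ z)) ⟩
  1Q                                 ∎
  where
  open ≡-Reasoning
  open ℚσ-Solver using (solve; _:=_; _:*_)
  N≢0 : normQ z ≢ 0ℚ
  N≢0 = z≢0 ∘ normQ≡0⇒≡0 z
  instance _ = ℚ.≢-nonZero N≢0
  t = 1/ normQ z
  re-real : ∀ t n → t ℚ.* n ℚ.- 0ℚ ℚ.* 0ℚ ≡ t ℚ.* n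
  re-real = solve-∀ ℚ-ring
  im-real : ∀ t n → t ℚ.* 0ℚ ℚ.+ 0ℚ ℚ.* n ℚ.+ 0ℚ ℚ.* 0ℚ ≡ 0ℚ
  im-real = solve-∀ ℚ-ring

*Q-≢0 : ∀ x y → x ≢ 0Q → y ≢ 0Q → x *Q y ≢ 0Q
*Q-≢0 x y x≢0 y≢0 xy≡0 = y≢0 (begin
  y                       ≡⟨ *Q-identityˡ y ⟨
  1Q *Q y                 ≡⟨ cong (_*Q y) (trans (*Q-comm (invQ x) x) (*Q-invQ x x≢0)) ⟨
  (invQ x *Q x) *Q y      ≡⟨ *Q-assoc (invQ x) x y ⟩
  invQ x *Q (x *Q y)      ≡⟨ cong (invQ x *Q_) xy≡0 ⟩
  invQ x *Q 0Q            ≡⟨ *Q-zeroʳ (invQ x) ⟩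
  0Q                      ∎)
  where open ≡-Reasoning

-- embed goes through x / 1, which normalises; its arithmetic is transported from ℚᵘ.
private
  toℚᵘ[x/1] : ∀ x → ℚ.toℚᵘ (x ℚ./ 1) ℚᵘ.≃ mkℚᵘ x 0
  toℚᵘ[x/1] x = ℚP.toℚᵘ-fromℚᵘ (mkℚᵘ x 0)

  /1-+ : ∀ x y → (x + y) ℚ./ 1 ≡ x ℚ./ 1 ℚ.+ y ℚ./ 1
  /1-+ x y = ℚP.toℚᵘ-injective (begin
    ℚ.toℚᵘ ((x + y) ℚ./ 1)                         ≈⟨ toℚᵘ[x/1] (x + y) ⟩
    mkℚᵘ (x + y) 0                                 ≈⟨ *≡* (sum x y) ⟩
    mkℚᵘ x 0 ℚᵘ.+ mkℚᵘ y 0                         ≈⟨ ℚᵘP.+-cong (toℚᵘ[x/1] x) (toℚᵘ[x/1] y) ⟨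
    ℚ.toℚᵘ (x ℚ./ 1) ℚᵘ.+ ℚ.toℚᵘ (y ℚ./ 1)         ≈⟨ ℚP.toℚᵘ-homo-+ (x ℚ./ 1) (y ℚ./ 1) ⟨
    ℚ.toℚᵘ (x ℚ./ 1 ℚ.+ y ℚ./ 1)                   ∎)
    where
    open ℚᵘP.≃-Reasoning
    sum : ∀ x y → (x + y) * + 1 ≡ (x * + 1 + y * + 1) * + 1
    sum = solve-∀ ℤ-ring

  /1-* : ∀ x y → (x * y) ℚ./ 1 ≡ (x ℚ./ 1) ℚ.* (y ℚ./ 1)
  /1-* x y = ℚP.toℚᵘ-injective (begin
    ℚ.toℚᵘ ((x * y) ℚ./ 1)                         ≈⟨ toℚᵘ[x/1] (x * y) ⟩
    mkℚᵘ (x * y) 0                                 ≈⟨ *≡* (product x y) ⟩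
    mkℚᵘ x 0 ℚᵘ.* mkℚᵘ y 0                         ≈⟨ ℚᵘP.*-cong (toℚᵘ[x/1] x) (toℚᵘ[x/1] y) ⟨
    ℚ.toℚᵘ (x ℚ./ 1) ℚᵘ.* ℚ.toℚᵘ (y ℚ./ 1)         ≈⟨ ℚP.toℚᵘ-homo-* (x ℚ./ 1) (y ℚ./ 1) ⟨
    ℚ.toℚᵘ ((x ℚ./ 1) ℚ.* (y ℚ./ 1))               ∎)
    where
    open ℚᵘP.≃-Reasoning
    product : ∀ x y → (x * y) * (+ 1 * + 1) ≡ (x * y) * + 1
    product = solve-∀ ℤ-ring

  /1-neg : ∀ x → (ℤ.- x) ℚ./ 1 ≡ ℚ.- (x ℚ./ 1)
  /1-neg x = ℚP.toℚᵘ-injective (begin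
    ℚ.toℚᵘ ((ℤ.- x) ℚ./ 1)      ≈⟨ toℚᵘ[x/1] (ℤ.- x) ⟩
    mkℚᵘ (ℤ.- x) 0              ≈⟨ ℚᵘP.-‿cong (toℚᵘ[x/1] x) ⟨
    ℚᵘ.- ℚ.toℚᵘ (x ℚ./ 1)       ≈⟨ ℚP.toℚᵘ-homo‿- (x ℚ./ 1) ⟨
    ℚ.toℚᵘ (ℚ.- (x ℚ./ 1))      ∎)
    where open ℚᵘP.≃-Reasoning

  /1-injective : ∀ x y → x ℚ./ 1 ≡ y ℚ./ 1 → x ≡ y
  /1-injective x y eq with ℚᵘP.≃-trans (ℚᵘP.≃-sym (toℚᵘ[x/1] x)) (ℚᵘP.≃-trans (ℚP.toℚᵘ-cong eq) (toℚᵘ[x/1] y))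
  ... | *≡* x*1≡y*1 = ℤP.*-cancelʳ-≡ x y (+ 1) x*1≡y*1

embed-+ : ∀ x y → embed (x +ℤσ y) ≡ embed x +Q embed y
embed-+ (a + b σ) (c + d σ) = cong₂ _+_σ' (/1-+ a c) (/1-+ b d)

embed-* : ∀ x y → embed (x *ℤσ y) ≡ embed x *Q embed y
embed-* (a + b σ) (c + d σ) = cong₂ _+_σ'
  (trans (/1-+ (a * c) (ℤ.- (b * d))) (cong₂ ℚ._+_ (/1-* a c) (trans (/1-neg (b * d)) (cong ℚ.-_ (/1-* b d)))))
  (trans (/1-+ (a * d + b * c) (b * d)) (cong₂ ℚ._+_ (trans (/1-+ (a * d) (b * c)) (cong₂ ℚ._+_ (/1-* a d) (/1-* b c))) (/1-* b d)))

embed-conj : ∀ x → embed (conjℤσ x) ≡ conj (embed x)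
embed-conj (a + b σ) = cong₂ _+_σ' (/1-+ a b) (/1-neg b)

embed-≢0 : ∀ x → x ≢ 0ℤσ → embed x ≢ 0Q
embed-≢0 (a + b σ) x≢0 eq = x≢0 (cong₂ _+_σ (/1-injective a (+ 0) (cong ℚσ.a eq)) (/1-injective b (+ 0) (cong ℚσ.b eq)))

embed-linear : ∀ a b p q → embed (a *ℤσ p +ℤσ b *ℤσ q) ≡ (embed a *Q embed p) +Q (embed b *Q embed q)
embed-linear a b p q = trans (embed-+ (a *ℤσ p) (b *ℤσ q)) (cong₂ _+Q_ (embed-* a p) (embed-* b q))

-- Boundary points in homogeneous coordinates

ℤσ² : Set
ℤσ² = ℤσ × ℤσ

point : ℤσ² → Point
point (p , q) = frac p q

infixl 6 _⊕_
infixr 7 _⊙_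

_⊕_ : ℤσ² → ℤσ² → ℤσ²
(p , q) ⊕ (r , s) = (p +ℤσ r) , (q +ℤσ s)

_⊙_ : ℤσ → ℤσ² → ℤσ²
l ⊙ (p , q) = (l *ℤσ p) , (l *ℤσ q)

divPoint : ℚσ → ℚσ → Point
divPoint n d with d ≟Q 0Q
... | yes _ = ∞
... | no  _ = just (n *Q invQ d)

divPoint≡∞ : ∀ {n d} → d ≡ 0Q → divPoint n d ≡ ∞
divPoint≡∞ refl = refl

divPoint≡just : ∀ {n d} z → d ≢ 0Q → z *Q d ≡ n → divPoint n d ≡ just z
divPoint≡just {n} {d} z d≢0 zd≡n with d ≟Q 0Q
... | yes d≡0 = contradiction d≡0 d≢0
... | no  _   = cong just (begin
  n *Q invQ d            ≡⟨ cong (_*Q invQ d) zd≡n ⟨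
  (z *Q d) *Q invQ d     ≡⟨ *Q-assoc z d (invQ d) ⟩
  z *Q (d *Q invQ d)     ≡⟨ cong (z *Q_) (*Q-invQ d d≢0) ⟩
  z *Q 1Q                ≡⟨ *Q-identityʳ z ⟩
  z                      ∎)
  where open ≡-Reasoning

divPoint-≢0 : ∀ n d → d ≢ 0Q → divPoint n d ≡ just (n *Q invQ d)
divPoint-≢0 n d d≢0 with d ≟Q 0Q
... | yes d≡0 = contradiction d≡0 d≢0
... | no  _   = refl

divPoint-scale : ∀ l n d → l ≢ 0Q → divPoint (l *Q n) (l *Q d) ≡ divPoint n d
divPoint-scale l n d l≢0 with d ≟Q 0Q
... | yes refl = divPoint≡∞ (*Q-zeroʳ l)
... | no  d≢0  = divPoint≡just (n *Q invQ d) (*Q-≢0 l d l≢0 d≢0) (begin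
  (n *Q invQ d) *Q (l *Q d)     ≡⟨ solve 4 (λ n d d⁻¹ l → (n :* d⁻¹) :* (l :* d) := (l :* n) :* (d :* d⁻¹)) refl n d (invQ d) l ⟩
  (l *Q n) *Q (d *Q invQ d)     ≡⟨ cong ((l *Q n) *Q_) (*Q-invQ d d≢0) ⟩
  (l *Q n) *Q 1Q                ≡⟨ *Q-identityʳ (l *Q n) ⟩
  l *Q n                        ∎)
  where
  open ≡-Reasoning
  open ℚσ-Solver using (solve; _:=_; _:*_)

frac≡divPoint : ∀ p q → frac p q ≡ divPoint (embed p) (embed q)
frac≡divPoint p q@(a + b σ) with (a ℤ.≟ + 0) ×-dec (b ℤ.≟ + 0)
... | yes (refl , refl) = refl
... | no  q≢0           = sym (divPoint-≢0 (embed p) (embed q) (embed-≢0 q λ { refl → q≢0 (refl , refl) }))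

point-⊙ : ∀ l v → l ≢ 0ℤσ → point (l ⊙ v) ≡ point v
point-⊙ l (p , q) l≢0 = begin
  frac (l *ℤσ p) (l *ℤσ q)                                ≡⟨ frac≡divPoint (l *ℤσ p) (l *ℤσ q) ⟩
  divPoint (embed (l *ℤσ p)) (embed (l *ℤσ q))            ≡⟨ cong₂ divPoint (embed-* l p) (embed-* l q) ⟩
  divPoint (embed l *Q embed p) (embed l *Q embed q)      ≡⟨ divPoint-scale (embed l) (embed p) (embed q) (embed-≢0 l l≢0) ⟩
  divPoint (embed p) (embed q)                            ≡⟨ frac≡divPoint p q ⟨
  frac p q                                                ∎
  where open ≡-Reasoning

conj² : ℤσ² → ℤσ²
conj² (p , q) = conjℤσ p , conjℤσ q

conjPoint : Point → Point
conjPoint = Maybe.map conj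

conjPoint-divPoint : ∀ n d → conjPoint (divPoint n d) ≡ divPoint (conj n) (conj d)
conjPoint-divPoint n d with d ≟Q 0Q
... | yes refl = refl
... | no  d≢0  = sym (divPoint≡just (conj (n *Q invQ d)) (conjQ-≢0 d d≢0) (begin
  conj (n *Q invQ d) *Q conj d     ≡⟨ conjQ-* (n *Q invQ d) d ⟨
  conj ((n *Q invQ d) *Q d)        ≡⟨ cong conj (trans (*Q-assoc n (invQ d) d) (cong (n *Q_) (trans (*Q-comm (invQ d) d) (*Q-invQ d d≢0)))) ⟩
  conj (n *Q 1Q)                   ≡⟨ cong conj (*Q-identityʳ n) ⟩
  conj n                           ∎))
  where open ≡-Reasoning

point-conj : ∀ v → point (conj² v) ≡ conjPoint (point v)
point-conj (p , q) = begin
  frac (conjℤσ p) (conjℤσ q)                            ≡⟨ frac≡divPoint (conjℤσ p) (conjℤσ q) ⟩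
  divPoint (embed (conjℤσ p)) (embed (conjℤσ q))        ≡⟨ cong₂ divPoint (embed-conj p) (embed-conj q) ⟩
  divPoint (conj (embed p)) (conj (embed q))            ≡⟨ conjPoint-divPoint (embed p) (embed q) ⟨
  conjPoint (divPoint (embed p) (embed q))              ≡⟨ cong conjPoint (frac≡divPoint p q) ⟨
  conjPoint (frac p q)                                  ∎
  where open ≡-Reasoning

record Matrix : Set where
  constructor mat
  field
    m₁₁ m₁₂ m₂₁ m₂₂ : ℤσ

infixr 7 _·_

_·_ : Matrix → ℤσ² → ℤσ²
mat a b c d · (p , q) = (a *ℤσ p +ℤσ b *ℤσ q) , (c *ℤσ p +ℤσ d *ℤσ q)

möbius : Matrix → Point → Point
möbius (mat a b c d) nothing  = divPoint (embed a) (embed c)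
möbius (mat a b c d) (just z) = divPoint ((embed a *Q z) +Q embed b) ((embed c *Q z) +Q embed d)

0² : ℤσ²
0² = 0ℤσ , 0ℤσ

möbius-point : ∀ M v → v ≢ 0² → möbius M (point v) ≡ point (M · v)
möbius-point (mat a b c d) (p , q) v≢0 with q ≟ℤσ 0ℤσ
... | yes refl = begin
  divPoint A C                                            ≡⟨ divPoint-scale P A C (embed-≢0 p λ { refl → v≢0 refl }) ⟨
  divPoint (P *Q A) (P *Q C)                              ≡⟨ cong₂ divPoint (at-∞ a b) (at-∞ c d) ⟨
  divPoint (embed (a *ℤσ p +ℤσ b *ℤσ 0ℤσ)) (embed (c *ℤσ p +ℤσ d *ℤσ 0ℤσ)) ≡⟨ frac≡divPoint _ _ ⟨
  point (mat a b c d · (p , 0ℤσ))                         ∎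
  where
  open ≡-Reasoning
  open ℚσ-Solver using (solve; _:=_; _:+_; _:*_; con)
  A = embed a
  C = embed c
  P = embed p
  at-∞ : ∀ x y → embed (x *ℤσ p +ℤσ y *ℤσ 0ℤσ) ≡ P *Q embed x
  at-∞ x y = trans (embed-linear x y p 0ℤσ) (solve 3 (λ X Y P → (X :* P) :+ (Y :* con 0Q) := P :* X) refl (embed x) (embed y) P)
... | no  q≢0 = begin
  möbius (mat a b c d) (frac p q)                         ≡⟨ cong (möbius (mat a b c d)) (trans (frac≡divPoint p q) (divPoint-≢0 P Q Q≢0)) ⟩
  divPoint ((A *Q z) +Q B) ((C *Q z) +Q D)                ≡⟨ divPoint-scale Q _ _ Q≢0 ⟨
  divPoint (Q *Q ((A *Q z) +Q B)) (Q *Q ((C *Q z) +Q D))  ≡⟨ cong₂ divPoint (clear a b) (clear c d) ⟩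
  divPoint (embed (a *ℤσ p +ℤσ b *ℤσ q)) (embed (c *ℤσ p +ℤσ d *ℤσ q)) ≡⟨ frac≡divPoint _ _ ⟨
  point (mat a b c d · (p , q))                           ∎
  where
  open ≡-Reasoning
  open ℚσ-Solver using (solve; _:=_; _:+_; _:*_)
  A = embed a
  B = embed b
  C = embed c
  D = embed d
  P = embed p
  Q = embed q
  Q≢0 = embed-≢0 q q≢0
  z = P *Q invQ Q
  zQ≡P : z *Q Q ≡ P
  zQ≡P = begin
    (P *Q invQ Q) *Q Q   ≡⟨ solve 3 (λ P Q⁻¹ Q → (P :* Q⁻¹) :* Q := P :* (Q :* Q⁻¹)) refl P (invQ Q) Q ⟩
    P *Q (Q *Q invQ Q)   ≡⟨ cong (P *Q_) (*Q-invQ Q Q≢0) ⟩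
    P *Q 1Q              ≡⟨ *Q-identityʳ P ⟩
    P                    ∎
  clear : ∀ x y → Q *Q ((embed x *Q z) +Q embed y) ≡ embed (x *ℤσ p +ℤσ y *ℤσ q)
  clear x y = begin
    Q *Q ((embed x *Q z) +Q embed y)      ≡⟨ solve 4 (λ X Y z Q → Q :* ((X :* z) :+ Y) := (X :* (z :* Q)) :+ (Y :* Q)) refl (embed x) (embed y) z Q ⟩
    (embed x *Q (z *Q Q)) +Q (embed y *Q Q) ≡⟨ cong (λ w → (embed x *Q w) +Q (embed y *Q Q)) zQ≡P ⟩
    (embed x *Q P) +Q (embed y *Q Q)      ≡⟨ embed-linear x y p q ⟨
    embed (x *ℤσ p +ℤσ y *ℤσ q)           ∎

-- The reflections in the faces of T act on the boundary as z ↦ (a z̄ + b) / (c z̄ + d);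
-- for the hemisphere, c + (1/3) / (z̄ - c̄) = z̄ / ((2 - σ) z̄ + (σ - 1)).
pattern r₁ = zero
pattern r₂ = suc zero
pattern r₃ = suc (suc zero)
pattern r₄ = suc (suc (suc zero))

reflectionMatrix : Fin 4 → Matrix
reflectionMatrix r₁ = mat 1ℤσ 0ℤσ 0ℤσ 1ℤσ
reflectionMatrix r₂ = mat (σ^ℕ 2) 0ℤσ 0ℤσ 1ℤσ
reflectionMatrix r₃ = mat (σ^ℕ 4) (1ℤσ +ℤσ σℤ) 0ℤσ 1ℤσ
reflectionMatrix r₄ = mat 1ℤσ 0ℤσ ((+ 2) + -[1+ 0 ] σ) (σ^ℕ 2)

private
  möbius-affine : ∀ a b z → möbius (mat a b 0ℤσ 1ℤσ) (just z) ≡ just ((embed a *Q z) +Q embed b)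
  möbius-affine a b z = divPoint≡just ((embed a *Q z) +Q embed b) den≢0
    (solve 2 (λ n z → n :* ((con 0Q :* z) :+ con 1Q) := n) refl ((embed a *Q z) +Q embed b) z)
    where
    open ℚσ-Solver using (solve; _:=_; _:+_; _:*_; con)
    den≢0 : (0Q *Q z) +Q 1Q ≢ 0Q
    den≢0 den≡0 = ℚP.1≢0 (cong ℚσ.a (trans (solve 1 (λ z → con 1Q := (con 0Q :* z) :+ con 1Q) refl z) den≡0))

  2-σ : ℚσ
  2-σ = embed ((+ 2) + -[1+ 0 ] σ)

  -- because (2 - σ) c̄ = 1 - σ = -σ²
  hemisphere-denominator : ∀ w → (2-σ *Q w) +Q σ²Q ≡ 2-σ *Q (w -Q conj cQ)
  hemisphere-denominator = solve 1 (λ w → (con 2-σ :* w) :+ con σ²Q := con 2-σ :* (w :- con (conj cQ))) refl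
    where open ℚσ-Solver using (solve; _:=_; _:+_; _:*_; _:-_; con)

  hemisphere-reflection : ∀ z → refl₄ (just z) ≡ möbius (reflectionMatrix r₄) (just (conj z))
  hemisphere-reflection z with (ℚσ.a (conj z -Q conj cQ) ℚ.≟ 0ℚ) ×-dec (ℚσ.b (conj z -Q conj cQ) ℚ.≟ 0ℚ)
  ... | yes (re≡0 , im≡0) =
    sym (divPoint≡∞ (trans (hemisphere-denominator (conj z)) (cong (2-σ *Q_) (cong₂ _+_σ' re≡0 im≡0))))
  ... | no ¬X≡0 = sym (divPoint≡just (cQ +Q (t3 ·Q invQ X)) den≢0 (begin
    (cQ +Q (t3 ·Q invQ X)) *Q ((2-σ *Q w) +Q σ²Q)     ≡⟨ cong₂ (λ u v → (cQ +Q u) *Q v) (·Q≡*Q t3 (invQ X)) (hemisphere-denominator w) ⟩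
    (cQ +Q ((t3 + 0ℚ σ') *Q invQ X)) *Q (2-σ *Q X)    ≡⟨ solve 2 (λ X X⁻¹ → (con cQ :+ (con (t3 + 0ℚ σ') :* X⁻¹)) :* (con 2-σ :* X)
                                                                     := X :+ (con (conj cQ) :* (X :* X⁻¹))) refl X (invQ X) ⟩
    X +Q (conj cQ *Q (X *Q invQ X))                   ≡⟨ cong (λ u → X +Q (conj cQ *Q u)) (*Q-invQ X X≢0) ⟩
    X +Q (conj cQ *Q 1Q)                              ≡⟨ solve 1 (λ w → (w :- con (conj cQ)) :+ (con (conj cQ) :* con 1Q)
                                                                     := (con 1Q :* w) :+ con 0Q) refl w ⟩
    (1Q *Q w) +Q 0Q                                   ∎))
    where
    open ≡-Reasoning
    open ℚσ-Solver using (solve; _:=_; _:+_; _:*_; _:-_; con)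
    w = conj z
    X = w -Q conj cQ
    t3 = (+ 1) ℚ./ 3
    X≢0 : X ≢ 0Q
    X≢0 X≡0 = ¬X≡0 (cong ℚσ.a X≡0 , cong ℚσ.b X≡0)
    den≢0 : (2-σ *Q w) +Q σ²Q ≢ 0Q
    den≢0 den≡0 = *Q-≢0 2-σ X (embed-≢0 ((+ 2) + -[1+ 0 ] σ) λ ()) X≢0 (trans (sym (hemisphere-denominator w)) den≡0)

reflection≡möbius∘conj : ∀ g x → reflection g x ≡ möbius (reflectionMatrix g) (conjPoint x)
reflection≡möbius∘conj r₁ nothing  = refl
reflection≡möbius∘conj r₁ (just z) = sym (trans (möbius-affine 1ℤσ 0ℤσ (conj z))
  (cong just (solve 1 (λ w → (con 1Q :* w) :+ con 0Q := w) refl (conj z))))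
  where open ℚσ-Solver using (solve; _:=_; _:+_; _:*_; con)
reflection≡möbius∘conj r₂ nothing  = refl
reflection≡möbius∘conj r₂ (just z) = sym (trans (möbius-affine (σ^ℕ 2) 0ℤσ (conj z))
  (cong just (solve 1 (λ w → (con σ²Q :* w) :+ con 0Q := con σ²Q :* w) refl (conj z))))
  where open ℚσ-Solver using (solve; _:=_; _:+_; _:*_; con)
reflection≡möbius∘conj r₃ nothing  = refl
reflection≡möbius∘conj r₃ (just z) = sym (trans (möbius-affine (σ^ℕ 4) (1ℤσ +ℤσ σℤ) (conj z))
  (cong just (solve 1 (λ w → (con σ⁴Q :* w) :+ con (embed (1ℤσ +ℤσ σℤ)) := con 1Q :+ (con σ⁴Q :* (w :- con 1Q))) refl (conj z))))
  where open ℚσ-Solver using (solve; _:=_; _:+_; _:*_; _:-_; con)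
reflection≡möbius∘conj r₄ nothing  = refl
reflection≡möbius∘conj r₄ (just z) = hemisphere-reflection z

twist : Bool → ℤσ → ℤσ
twist false l = l
twist true  l = conjℤσ l

record Semilinear (c : Bool) (F : ℤσ² → ℤσ²) : Set where
  field
    additive    : ∀ v w → F (v ⊕ w) ≡ F v ⊕ F w
    homogeneous : ∀ l v → F (l ⊙ v) ≡ twist c l ⊙ F v
open Semilinear public

e₁ e₂ : ℤσ²
e₁ = 1ℤσ , 0ℤσ
e₂ = 0ℤσ , 1ℤσ

semilinear-ext : ∀ {c F G} → Semilinear c F → Semilinear c G →
                 F e₁ ≡ G e₁ → F e₂ ≡ G e₂ → ∀ v → F v ≡ G v
semilinear-ext {c} {F} {G} SF SG Fe₁≡Ge₁ Fe₂≡Ge₂ v@(p , q) = begin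
  F v                                    ≡⟨ cong F (basis p q) ⟩
  F (p ⊙ e₁ ⊕ q ⊙ e₂)                    ≡⟨ expand SF ⟩
  twist c p ⊙ F e₁ ⊕ twist c q ⊙ F e₂    ≡⟨ cong₂ (λ x y → twist c p ⊙ x ⊕ twist c q ⊙ y) Fe₁≡Ge₁ Fe₂≡Ge₂ ⟩
  twist c p ⊙ G e₁ ⊕ twist c q ⊙ G e₂    ≡⟨ expand SG ⟨
  G (p ⊙ e₁ ⊕ q ⊙ e₂)                    ≡⟨ cong G (basis p q) ⟨
  G v                                    ∎
  where
  open ≡-Reasoning
  open ℤσ-Solver using (solve; _:=_; _:+_; _:*_; con)
  basis : ∀ p q → (p , q) ≡ p ⊙ e₁ ⊕ q ⊙ e₂
  basis p q = cong₂ _,_ (solve 2 (λ p q → p := p :* con 1ℤσ :+ q :* con 0ℤσ) refl p q)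
                        (solve 2 (λ p q → q := p :* con 0ℤσ :+ q :* con 1ℤσ) refl p q)
  expand : ∀ {H} → Semilinear c H → H (p ⊙ e₁ ⊕ q ⊙ e₂) ≡ twist c p ⊙ H e₁ ⊕ twist c q ⊙ H e₂
  expand SH = trans (additive SH _ _) (cong₂ _⊕_ (homogeneous SH p e₁) (homogeneous SH q e₂))

semilinear-id : Semilinear false id
semilinear-id = record { additive = λ _ _ → refl ; homogeneous = λ _ _ → refl }

semilinear-∘ : ∀ {c d F G} → Semilinear c F → Semilinear d G → Semilinear (c xor d) (F ∘ G)
semilinear-∘ {c} {d} {F} {G} SF SG = record
  { additive    = λ v w → trans (cong F (additive SG v w)) (additive SF (G v) (G w))
  ; homogeneous = λ l v → trans (cong F (homogeneous SG l v))
                                (trans (homogeneous SF (twist d l) (G v)) (cong (_⊙ F (G v)) (twist-twist c d l))) }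
  where
  twist-twist : ∀ c d l → twist c (twist d l) ≡ twist (c xor d) l
  twist-twist false d    l = refl
  twist-twist true false l = refl
  twist-twist true true  l = conjℤσ-involutive l

semilinear-scale : ∀ {c F} m → Semilinear c F → Semilinear c (λ v → m ⊙ F v)
semilinear-scale {c} {F} m SF = record
  { additive    = λ v w → trans (cong (m ⊙_) (additive SF v w)) (⊙-distrib m (F v) (F w))
  ; homogeneous = λ l v → trans (cong (m ⊙_) (homogeneous SF l v)) (⊙-comm m (twist c l) (F v)) }
  where
  open ℤσ-Solver using (solve; _:=_; _:*_)
  ⊙-distrib : ∀ m v w → m ⊙ (v ⊕ w) ≡ m ⊙ v ⊕ m ⊙ w
  ⊙-distrib m (p , q) (r , s) = cong₂ _,_ (*ℤσ-distribˡ-+ℤσ m p r) (*ℤσ-distribˡ-+ℤσ m q s)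
  ⊙-comm : ∀ m l v → m ⊙ (l ⊙ v) ≡ l ⊙ (m ⊙ v)
  ⊙-comm m l (p , q) = cong₂ _,_ (solve 3 (λ m l p → m :* (l :* p) := l :* (m :* p)) refl m l p)
                                 (solve 3 (λ m l q → m :* (l :* q) := l :* (m :* q)) refl m l q)

·-linear : ∀ M → Semilinear false (M ·_)
·-linear (mat a b c d) = record
  { additive    = λ { (p , q) (r , s) → cong₂ _,_ (additive-row a b p q r s) (additive-row c d p q r s) }
  ; homogeneous = λ { l (p , q) → cong₂ _,_ (homogeneous-row a b l p q) (homogeneous-row c d l p q) } }
  where
  open ℤσ-Solver using (solve; _:=_; _:+_; _:*_)
  additive-row : ∀ a b p q r s → a *ℤσ (p +ℤσ r) +ℤσ b *ℤσ (q +ℤσ s) ≡ (a *ℤσ p +ℤσ b *ℤσ q) +ℤσ (a *ℤσ r +ℤσ b *ℤσ s)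
  additive-row = solve 6 (λ a b p q r s → a :* (p :+ r) :+ b :* (q :+ s) := (a :* p :+ b :* q) :+ (a :* r :+ b :* s)) refl
  homogeneous-row : ∀ a b l p q → a *ℤσ (l *ℤσ p) +ℤσ b *ℤσ (l *ℤσ q) ≡ l *ℤσ (a *ℤσ p +ℤσ b *ℤσ q)
  homogeneous-row = solve 5 (λ a b l p q → a :* (l :* p) :+ b :* (l :* q) := l :* (a :* p :+ b :* q)) refl

conj²-semilinear : Semilinear true conj²
conj²-semilinear = record
  { additive    = λ { (p , q) (r , s) → cong₂ _,_ (conjℤσ-+ p r) (conjℤσ-+ q s) }
  ; homogeneous = λ { l (p , q) → cong₂ _,_ (conjℤσ-* l p) (conjℤσ-* l q) } }

reflect : Fin 4 → ℤσ² → ℤσ²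
reflect g v = reflectionMatrix g · conj² v

reflect-semilinear : ∀ g → Semilinear true (reflect g)
reflect-semilinear g = semilinear-∘ (·-linear (reflectionMatrix g)) conj²-semilinear

reflect-involutive : ∀ g v → reflect g (reflect g v) ≡ v
reflect-involutive g = semilinear-ext (semilinear-∘ (reflect-semilinear g) (reflect-semilinear g)) semilinear-id
  (on-e₁ g) (on-e₂ g)
  where
  on-e₁ : ∀ g → reflect g (reflect g e₁) ≡ e₁
  on-e₁ r₁ = refl
  on-e₁ r₂ = refl
  on-e₁ r₃ = refl
  on-e₁ r₄ = refl
  on-e₂ : ∀ g → reflect g (reflect g e₂) ≡ e₂
  on-e₂ r₁ = refl
  on-e₂ r₂ = refl
  on-e₂ r₃ = refl
  on-e₂ r₄ = refl

reflect-≢0 : ∀ g v → v ≢ 0² → reflect g v ≢ 0²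
reflect-≢0 g v v≢0 Av≡0 = v≢0 (begin
  v                     ≡⟨ reflect-involutive g v ⟨
  reflect g (reflect g v) ≡⟨ cong (reflect g) Av≡0 ⟩
  reflect g 0²          ≡⟨ homogeneous (reflect-semilinear g) 0ℤσ 0² ⟩
  0ℤσ ⊙ reflect g 0²    ≡⟨ cong₂ _,_ (*ℤσ-zeroˡ (proj₁ (reflect g 0²))) (*ℤσ-zeroˡ (proj₂ (reflect g 0²))) ⟩
  0²                    ∎)
  where open ≡-Reasoning

reflection-point : ∀ g v → v ≢ 0² → reflection g (point v) ≡ point (reflect g v)
reflection-point g v v≢0 = begin
  reflection g (point v)                            ≡⟨ reflection≡möbius∘conj g (point v) ⟩
  möbius (reflectionMatrix g) (conjPoint (point v)) ≡⟨ cong (möbius (reflectionMatrix g)) (point-conj v) ⟨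
  möbius (reflectionMatrix g) (point (conj² v))     ≡⟨ möbius-point (reflectionMatrix g) (conj² v) (conj²-≢0 v v≢0) ⟩
  point (reflect g v)                               ∎
  where
  open ≡-Reasoning
  conj²-≢0 : ∀ v → v ≢ 0² → conj² v ≢ 0²
  conj²-≢0 (p , q) v≢0 v̄≡0 = v≢0 (cong₂ _,_ (conj≡0 p (cong proj₁ v̄≡0)) (conj≡0 q (cong proj₂ v̄≡0)))
    where
    conj≡0 : ∀ x → conjℤσ x ≡ 0ℤσ → x ≡ 0ℤσ
    conj≡0 x x̄≡0 = trans (sym (conjℤσ-involutive x)) (cong conjℤσ x̄≡0)

reflectWord : Word → ℤσ² → ℤσ²
reflectWord []      v = v
reflectWord (g ∷ h) v = reflect g (reflectWord h v)

reflectWord-≢0 : ∀ h v → v ≢ 0² → reflectWord h v ≢ 0²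
reflectWord-≢0 []      v v≢0 = v≢0
reflectWord-≢0 (g ∷ h) v v≢0 = reflect-≢0 g (reflectWord h v) (reflectWord-≢0 h v v≢0)

act-point : ∀ h v → v ≢ 0² → act h (point v) ≡ point (reflectWord h v)
act-point []      v v≢0 = refl
act-point (g ∷ h) v v≢0 = trans (cong (reflection g) (act-point h v v≢0))
                                (reflection-point g (reflectWord h v) (reflectWord-≢0 h v v≢0))

det : ℤσ² → ℤσ² → ℤσ
det (p , q) (r , s) = p *ℤσ s -ℤσ r *ℤσ q

Unimodular : ℤσ² → ℤσ² → Set
Unimodular v w = IsUnit (det v w)

det-⊙ʳ : ∀ u v w → det v (u ⊙ w) ≡ u *ℤσ det v w
det-⊙ʳ u (p , q) (r , s) =
  solve 5 (λ u p q r s → p :* (u :* s) :- (u :* r) :* q := u :* (p :* s :- r :* q)) refl u p q r s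
  where open ℤσ-Solver using (solve; _:=_; _:*_; _:-_)

unimodular-⊙ʳ : ∀ u v w → IsUnit u → Unimodular v w → Unimodular v (u ⊙ w)
unimodular-⊙ʳ u v w uu uvw = subst IsUnit (sym (det-⊙ʳ u v w)) (IsUnit-* u (det v w) uu uvw)

unimodular-≢0ˡ : ∀ v w → Unimodular v w → v ≢ 0²
unimodular-≢0ˡ _ (r , s) u refl = IsUnit⇒≢0 (det 0² (r , s)) u (solve 2 (λ r s → con 0ℤσ :* s :- r :* con 0ℤσ := con 0ℤσ) refl r s)
  where open ℤσ-Solver using (solve; _:=_; _:*_; _:-_; con)

unimodular-≢0ʳ : ∀ v w → Unimodular v w → w ≢ 0²
unimodular-≢0ʳ (p , q) _ u refl = IsUnit⇒≢0 (det (p , q) 0²) u (solve 2 (λ p q → p :* con 0ℤσ :- con 0ℤσ :* q := con 0ℤσ) refl p q)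
  where open ℤσ-Solver using (solve; _:=_; _:*_; _:-_; con)

unimodular-⊕⊙ : ∀ v w l → Unimodular v w → Unimodular (v ⊕ l ⊙ w) w
unimodular-⊕⊙ (p , q) (r , s) l = subst IsUnit (sym
  (solve 5 (λ p q r s l → (p :+ l :* r) :* s :- r :* (q :+ l :* s) := p :* s :- r :* q) refl p q r s l))
  where open ℤσ-Solver using (solve; _:=_; _:+_; _:*_; _:-_)

tetrahedron : ℤσ² → ℤσ² → List Point
tetrahedron v w = point v ∷ point w ∷ point (v ⊕ w) ∷ point (v ⊕ σℤ ⊙ w) ∷ []

determinant : Matrix → ℤσ
determinant (mat a b c d) = a *ℤσ d -ℤσ b *ℤσ c

det-· : ∀ M v w → det (M · v) (M · w) ≡ determinant M *ℤσ det v w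
det-· (mat a b c d) (p , q) (r , s) = solve 8 (λ a b c d p q r s →
  (a :* p :+ b :* q) :* (c :* r :+ d :* s) :- (a :* r :+ b :* s) :* (c :* p :+ d :* q)
  := (a :* d :- b :* c) :* (p :* s :- r :* q)) refl a b c d p q r s
  where open ℤσ-Solver using (solve; _:=_; _:+_; _:*_; _:-_)

det-conj² : ∀ v w → det (conj² v) (conj² w) ≡ conjℤσ (det v w)
det-conj² (p , q) (r , s) = sym (begin
  conjℤσ (p *ℤσ s -ℤσ r *ℤσ q)                    ≡⟨ conjℤσ-- (p *ℤσ s) (r *ℤσ q) ⟩
  conjℤσ (p *ℤσ s) -ℤσ conjℤσ (r *ℤσ q)           ≡⟨ cong₂ _-ℤσ_ (conjℤσ-* p s) (conjℤσ-* r q) ⟩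
  conjℤσ p *ℤσ conjℤσ s -ℤσ conjℤσ r *ℤσ conjℤσ q ∎)
  where open ≡-Reasoning

unimodular-reflect : ∀ g v w → Unimodular v w → Unimodular (reflect g v) (reflect g w)
unimodular-reflect g v w u = subst IsUnit (sym (trans (det-· (reflectionMatrix g) (conj² v) (conj² w))
                                                       (cong (determinant (reflectionMatrix g) *ℤσ_) (det-conj² v w))))
  (IsUnit-* (determinant (reflectionMatrix g)) (conjℤσ (det v w)) (unit-determinant g) (IsUnit-conj (det v w) u))
  where
  unit-determinant : ∀ g → IsUnit (determinant (reflectionMatrix g))
  unit-determinant r₁ = refl
  unit-determinant r₂ = refl
  unit-determinant r₃ = refl
  unit-determinant r₄ = refl

⊙-identityˡ : ∀ v → 1ℤσ ⊙ v ≡ v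
⊙-identityˡ (p , q) = cong₂ _,_ (*ℤσ-identityˡ p) (*ℤσ-identityˡ q)

⊙-assoc : ∀ l m v → l ⊙ (m ⊙ v) ≡ (l *ℤσ m) ⊙ v
⊙-assoc l m (p , q) = cong₂ _,_ (sym (*ℤσ-assoc l m p)) (sym (*ℤσ-assoc l m q))

-- A reflection reverses orientation, so it exchanges the roles of σ and σ̄ = σ⁻¹.
reflection-tetrahedron : ∀ g v w → Unimodular v w →
  map (reflection g) (tetrahedron v w) ↭ tetrahedron (reflect g v) (conjℤσ σℤ ⊙ reflect g w)
reflection-tetrahedron g v w u = ↭-trans (↭-reflexive images) (↭-prep _ (↭-prep _ (↭-swap _ _ ↭-refl)))
  where
  A = reflect g
  σ̄ = conjℤσ σℤ
  open ≡-Reasoning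
  v⊕w≢0 : v ⊕ w ≢ 0²
  v⊕w≢0 = subst (λ x → v ⊕ x ≢ 0²) (⊙-identityˡ w) (unimodular-≢0ˡ (v ⊕ 1ℤσ ⊙ w) w (unimodular-⊕⊙ v w 1ℤσ u))
  images : map (reflection g) (tetrahedron v w)
         ≡ point (A v) ∷ point (σ̄ ⊙ A w) ∷ point (A v ⊕ σℤ ⊙ (σ̄ ⊙ A w)) ∷ point (A v ⊕ σ̄ ⊙ A w) ∷ []
  images = cong₂ _∷_ (reflection-point g v (unimodular-≢0ˡ v w u))
         ( cong₂ _∷_ (trans (reflection-point g w (unimodular-≢0ʳ v w u)) (sym (point-⊙ σ̄ (A w) (IsUnit⇒≢0 σ̄ refl))))
         ( cong₂ _∷_ (begin
             reflection g (point (v ⊕ w))     ≡⟨ reflection-point g (v ⊕ w) v⊕w≢0 ⟩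
             point (A (v ⊕ w))                ≡⟨ cong point (additive (reflect-semilinear g) v w) ⟩
             point (A v ⊕ A w)                ≡⟨ cong (λ x → point (A v ⊕ x)) (trans (sym (⊙-identityˡ (A w))) (sym (⊙-assoc σℤ σ̄ (A w)))) ⟩
             point (A v ⊕ σℤ ⊙ (σ̄ ⊙ A w))    ∎)
         ( cong₂ _∷_ (begin
             reflection g (point (v ⊕ σℤ ⊙ w)) ≡⟨ reflection-point g (v ⊕ σℤ ⊙ w) (unimodular-≢0ˡ (v ⊕ σℤ ⊙ w) w (unimodular-⊕⊙ v w σℤ u)) ⟩
             point (A (v ⊕ σℤ ⊙ w))            ≡⟨ cong point (trans (additive (reflect-semilinear g) v (σℤ ⊙ w))
                                                                     (cong (A v ⊕_) (homogeneous (reflect-semilinear g) σℤ w))) ⟩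
             point (A v ⊕ σ̄ ⊙ A w)            ∎)
           refl)))

vertices-T : vertices [] ↭ tetrahedron (0ℤσ , 1ℤσ) (1ℤσ , 0ℤσ)
vertices-T = ↭-prep _ (↭-trans (↭-prep _ (↭-swap _ _ ↭-refl)) (↭-swap _ _ ↭-refl))

vertices-tetrahedron : ∀ h → Σ ℤσ² λ v → Σ ℤσ² λ w → Unimodular v w × vertices h ↭ tetrahedron v w
vertices-tetrahedron [] = (0ℤσ , 1ℤσ) , (1ℤσ , 0ℤσ) , refl , vertices-T
vertices-tetrahedron (g ∷ h) =
  let v , w , u , h↭vw = vertices-tetrahedron h in
  reflect g v , conjℤσ σℤ ⊙ reflect g w ,
  unimodular-⊙ʳ (conjℤσ σℤ) (reflect g v) (reflect g w) refl (unimodular-reflect g v w u) ,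
  ↭-trans (map⁺ (reflection g) h↭vw) (reflection-tetrahedron g v w u)

-- Symmetries of the tiling

-- Homogeneous coordinates of 0, 1, σ, ∞; vertices h computes to map (act h ∘ point) T-vectors.
T-vectors : List ℤσ²
T-vectors = (0ℤσ , 1ℤσ) ∷ (1ℤσ , 1ℤσ) ∷ (σℤ , 1ℤσ) ∷ (1ℤσ , 0ℤσ) ∷ []

translation : ℤσ → Matrix
translation t = mat 1ℤσ t 0ℤσ 1ℤσ

inversion rotation : Matrix
inversion = mat 0ℤσ 1ℤσ 1ℤσ 0ℤσ
rotation  = mat σℤ 0ℤσ 0ℤσ 1ℤσ

tile-translation : vertices (r₃ ∷ r₁ ∷ []) ↭ map (möbius (translation 1ℤσ)) (vertices [])
tile-translation = ↭-trans (↭-swap _ _ ↭-refl) (↭-prep _ (↭-swap _ _ ↭-refl))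

tile-inversion : vertices (r₁ ∷ []) ↭ map (möbius inversion) (vertices [])
tile-inversion = ↭-trans (shift _ (_ ∷ _ ∷ _ ∷ []) []) (↭-prep _ (↭-sym (shift _ (_ ∷ _ ∷ []) [])))

tile-rotation : vertices (r₂ ∷ []) ↭ map (möbius rotation) (vertices [])
tile-rotation = ↭-prep _ (↭-swap _ _ ↭-refl)

parity : Word → Bool
parity []      = false
parity (_ ∷ h) = true xor parity h

reflectWord-semilinear : ∀ h → Semilinear (parity h) (reflectWord h)
reflectWord-semilinear []      = semilinear-id
reflectWord-semilinear (g ∷ h) = semilinear-∘ (reflect-semilinear g) (reflectWord-semilinear h)

reflectWord-++ : ∀ W h v → reflectWord (W ++ h) v ≡ reflectWord W (reflectWord h v)
reflectWord-++ []      h v = refl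
reflectWord-++ (g ∷ W) h v = cong (reflect g) (reflectWord-++ W h v)

vertices-++ : ∀ W h → vertices (W ++ h) ≡ map (act W) (vertices h)
vertices-++ W h = trans (map-cong (λ b → foldr-++ reflection (point b) W h) T-vectors) (map-∘ {g = act W} {f = act h ∘ point} T-vectors)

IsUnit-twist : ∀ c l → IsUnit l → IsUnit (twist c l)
IsUnit-twist false l u = u
IsUnit-twist true  l u = IsUnit-conj l u

-- M h = l W M as (anti)linear maps: conjugation by M sends the word h to the word W.
record Conjugation (M : Matrix) (h : Word) : Set where
  field
    scalar      : ℤσ
    word        : Word
    scalar-unit : IsUnit scalar
    intertwines : ∀ v → M · reflectWord h v ≡ scalar ⊙ reflectWord word (M · v)

conjugation-word : ∀ M → (∀ g → Conjugation M (g ∷ [])) → ∀ h → Conjugation M h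
conjugation-word M _ [] = record
  { scalar = 1ℤσ ; word = [] ; scalar-unit = refl ; intertwines = λ v → sym (⊙-identityˡ (M · v)) }
conjugation-word M conjugation-reflection (g ∷ h) = record
  { scalar      = l₁ *ℤσ twist (parity W₁) l₂
  ; word        = W₁ ++ W₂
  ; scalar-unit = IsUnit-* l₁ (twist (parity W₁) l₂) u₁ (IsUnit-twist (parity W₁) l₂ u₂)
  ; intertwines = λ v → begin
      M · reflect g (reflectWord h v)                          ≡⟨ eq₁ (reflectWord h v) ⟩
      l₁ ⊙ reflectWord W₁ (M · reflectWord h v)                ≡⟨ cong (λ x → l₁ ⊙ reflectWord W₁ x) (eq₂ v) ⟩
      l₁ ⊙ reflectWord W₁ (l₂ ⊙ reflectWord W₂ (M · v))        ≡⟨ cong (l₁ ⊙_) (homogeneous (reflectWord-semilinear W₁) l₂ _) ⟩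
      l₁ ⊙ (twist (parity W₁) l₂ ⊙ reflectWord W₁ (reflectWord W₂ (M · v)))
        ≡⟨ ⊙-assoc l₁ (twist (parity W₁) l₂) (reflectWord W₁ (reflectWord W₂ (M · v))) ⟩
      (l₁ *ℤσ twist (parity W₁) l₂) ⊙ reflectWord W₁ (reflectWord W₂ (M · v))
        ≡⟨ cong ((l₁ *ℤσ twist (parity W₁) l₂) ⊙_) (reflectWord-++ W₁ W₂ (M · v)) ⟨
      (l₁ *ℤσ twist (parity W₁) l₂) ⊙ reflectWord (W₁ ++ W₂) (M · v) ∎
  }
  where
  open ≡-Reasoning
  open Conjugation (conjugation-reflection g)
    renaming (scalar to l₁; word to W₁; scalar-unit to u₁; intertwines to eq₁)
  open Conjugation (conjugation-word M conjugation-reflection h)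
    renaming (scalar to l₂; word to W₂; scalar-unit to u₂; intertwines to eq₂)

-- Both sides are antilinear, so it suffices to compare them on e₁ and e₂.
conjugation-on-basis : ∀ M g l W → IsUnit l → parity W ≡ true →
  M · reflect g e₁ ≡ l ⊙ reflectWord W (M · e₁) → M · reflect g e₂ ≡ l ⊙ reflectWord W (M · e₂) →
  Conjugation M (g ∷ [])
conjugation-on-basis M g l W u odd on-e₁ on-e₂ = record
  { scalar = l ; word = W ; scalar-unit = u ; intertwines =
  semilinear-ext (semilinear-∘ (·-linear M) (reflect-semilinear g))
    (subst (λ c → Semilinear c (λ v → l ⊙ reflectWord W (M · v))) (cong (_xor false) odd)
           (semilinear-scale l (semilinear-∘ (reflectWord-semilinear W) (·-linear M))))
    on-e₁ on-e₂ }

record Symmetry (M : Matrix) : Set where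
  field
    determinant-unit : IsUnit (determinant M)
    image-of-T       : Σ Word λ h → vertices h ↭ map (möbius M) (vertices [])
    conjugation      : ∀ g → Conjugation M (g ∷ [])

translation-symmetry : Symmetry (translation 1ℤσ)
translation-symmetry = record
  { determinant-unit = refl
  ; image-of-T       = r₃ ∷ r₁ ∷ [] , tile-translation
  ; conjugation      = conjugation-reflection
  }
  where
  E = translation 1ℤσ
  conjugation-reflection : ∀ g → Conjugation E (g ∷ [])
  conjugation-reflection r₁ = conjugation-on-basis E r₁ 1ℤσ (r₁ ∷ []) refl refl refl refl
  conjugation-reflection r₂ = conjugation-on-basis E r₂ 1ℤσ (r₁ ∷ r₃ ∷ r₁ ∷ []) refl refl refl refl
  conjugation-reflection r₃ = conjugation-on-basis E r₃ 1ℤσ (r₃ ∷ r₁ ∷ r₂ ∷ r₁ ∷ r₃ ∷ []) refl refl refl refl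
  conjugation-reflection r₄ = conjugation-on-basis E r₄ (σ^ℕ 2) (r₃ ∷ r₁ ∷ r₄ ∷ r₁ ∷ r₃ ∷ []) refl refl refl refl

inversion-symmetry : Symmetry inversion
inversion-symmetry = record
  { determinant-unit = refl
  ; image-of-T       = r₁ ∷ [] , tile-inversion
  ; conjugation      = conjugation-reflection
  }
  where
  conjugation-reflection : ∀ g → Conjugation inversion (g ∷ [])
  conjugation-reflection r₁ = conjugation-on-basis inversion r₁ 1ℤσ (r₁ ∷ []) refl refl refl refl
  conjugation-reflection r₂ = conjugation-on-basis inversion r₂ (σ^ℕ 2) (r₁ ∷ r₂ ∷ r₁ ∷ []) refl refl refl refl
  conjugation-reflection r₃ = conjugation-on-basis inversion r₃ 1ℤσ (r₁ ∷ r₄ ∷ r₁ ∷ []) refl refl refl refl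
  conjugation-reflection r₄ = conjugation-on-basis inversion r₄ 1ℤσ (r₁ ∷ r₃ ∷ r₁ ∷ []) refl refl refl refl

rotation-symmetry : Symmetry rotation
rotation-symmetry = record
  { determinant-unit = refl
  ; image-of-T       = r₂ ∷ [] , tile-rotation
  ; conjugation      = conjugation-reflection
  }
  where
  conjugation-reflection : ∀ g → Conjugation rotation (g ∷ [])
  conjugation-reflection r₁ = conjugation-on-basis rotation r₁ 1ℤσ (r₂ ∷ []) refl refl refl refl
  conjugation-reflection r₂ = conjugation-on-basis rotation r₂ 1ℤσ (r₁ ∷ r₂ ∷ r₁ ∷ []) refl refl refl refl
  conjugation-reflection r₃ = conjugation-on-basis rotation r₃ 1ℤσ (r₂ ∷ r₃ ∷ r₂ ∷ []) refl refl refl refl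
  conjugation-reflection r₄ = conjugation-on-basis rotation r₄ (σ^ℕ 4) (r₂ ∷ r₄ ∷ r₂ ∷ []) refl refl refl refl

FundamentalPair : ℤσ² → ℤσ² → Set
FundamentalPair v w = Unimodular v w × Σ Word λ h → vertices h ↭ tetrahedron v w

Preserves : (ℤσ² → ℤσ²) → Set
Preserves F = ∀ v w → FundamentalPair v w → FundamentalPair (F v) (F w)

adjugate : Matrix → Matrix
adjugate (mat a b c d) = mat d (negℤσ b) (negℤσ c) a

adjugate-· : ∀ M v → adjugate M · (M · v) ≡ determinant M ⊙ v
adjugate-· (mat a b c d) (p , q) = cong₂ _,_
  (solve 6 (λ a b c d p q → d :* (a :* p :+ b :* q) :+ (:- b) :* (c :* p :+ d :* q) := (a :* d :- b :* c) :* p) refl a b c d p q)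
  (solve 6 (λ a b c d p q → (:- c) :* (a :* p :+ b :* q) :+ a :* (c :* p :+ d :* q) := (a :* d :- b :* c) :* q) refl a b c d p q)
  where open ℤσ-Solver using (solve; _:=_; _:+_; _:*_; _:-_; :-_)

·-≢0 : ∀ M v → IsUnit (determinant M) → v ≢ 0² → M · v ≢ 0²
·-≢0 M v@(p , q) u v≢0 Mv≡0 = v≢0 (cong₂ _,_ (cancel p (cong proj₁ Δv≡0)) (cancel q (cong proj₂ Δv≡0)))
  where
  Δ = determinant M
  Δv≡0 : Δ ⊙ v ≡ 0²
  Δv≡0 = begin
    Δ ⊙ v                   ≡⟨ adjugate-· M v ⟨
    adjugate M · (M · v)    ≡⟨ cong (adjugate M ·_) Mv≡0 ⟩
    adjugate M · 0²         ≡⟨ trans (homogeneous (·-linear (adjugate M)) 0ℤσ 0²) (cong₂ _,_ (*ℤσ-zeroˡ (proj₁ (adjugate M · 0²))) (*ℤσ-zeroˡ (proj₂ (adjugate M · 0²)))) ⟩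
    0²                      ∎
    where open ≡-Reasoning
  cancel : ∀ x → Δ *ℤσ x ≡ 0ℤσ → x ≡ 0ℤσ
  cancel x Δx≡0 with x ≟ℤσ 0ℤσ
  ... | yes x≡0 = x≡0
  ... | no  x≢0 = contradiction Δx≡0 (*ℤσ-≢0 Δ x (IsUnit⇒≢0 Δ u) x≢0)

möbius-tetrahedron : ∀ M v w → Unimodular v w → map (möbius M) (tetrahedron v w) ≡ tetrahedron (M · v) (M · w)
möbius-tetrahedron M v w u =
  cong₂ _∷_ (möbius-point M v (unimodular-≢0ˡ v w u))
  (cong₂ _∷_ (möbius-point M w (unimodular-≢0ʳ v w u))
  (cong₂ _∷_ (trans (möbius-point M (v ⊕ w) v⊕w≢0) (cong point (additive (·-linear M) v w)))
  (cong₂ _∷_ (trans (möbius-point M (v ⊕ σℤ ⊙ w) (unimodular-≢0ˡ (v ⊕ σℤ ⊙ w) w (unimodular-⊕⊙ v w σℤ u)))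
                    (cong point (trans (additive (·-linear M) v (σℤ ⊙ w)) (cong (M · v ⊕_) (homogeneous (·-linear M) σℤ w)))))
  refl)))
  where
  v⊕w≢0 : v ⊕ w ≢ 0²
  v⊕w≢0 = subst (λ x → v ⊕ x ≢ 0²) (⊙-identityˡ w) (unimodular-≢0ˡ (v ⊕ 1ℤσ ⊙ w) w (unimodular-⊕⊙ v w 1ℤσ u))

conjugate-point : ∀ {M h} → IsUnit (determinant M) → (C : Conjugation M h) →
  ∀ {b} → b ≢ 0² → act (Conjugation.word C) (möbius M (point b)) ≡ möbius M (act h (point b))
conjugate-point {M} {h} ΔM-unit C {b} b≢0 = begin
  act W (möbius M (point b))            ≡⟨ cong (act W) (möbius-point M b b≢0) ⟩
  act W (point (M · b))                 ≡⟨ act-point W (M · b) (·-≢0 M b ΔM-unit b≢0) ⟩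
  point (reflectWord W (M · b))         ≡⟨ point-⊙ l (reflectWord W (M · b)) (IsUnit⇒≢0 l scalar-unit) ⟨
  point (l ⊙ reflectWord W (M · b))     ≡⟨ cong point (intertwines b) ⟨
  point (M · reflectWord h b)           ≡⟨ möbius-point M (reflectWord h b) (reflectWord-≢0 h b b≢0) ⟨
  möbius M (point (reflectWord h b))    ≡⟨ cong (möbius M) (act-point h b b≢0) ⟨
  möbius M (act h (point b))            ∎
  where
  open ≡-Reasoning
  open Conjugation C renaming (scalar to l; word to W)

conjugate-vertices : ∀ {M h} → IsUnit (determinant M) → (C : Conjugation M h) →
  map (act (Conjugation.word C)) (map (möbius M) (vertices [])) ≡ map (möbius M) (vertices h)
conjugate-vertices {M} {h} ΔM-unit C = begin
  map (act W) (map (möbius M ∘ point) T-vectors)  ≡⟨ map-∘ {g = act W} {f = möbius M ∘ point} T-vectors ⟨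
  map (act W ∘ möbius M ∘ point) T-vectors        ≡⟨ map-cong-local (All.map (conjugate-point ΔM-unit C) T-vectors≢0) ⟩
  map (möbius M ∘ act h ∘ point) T-vectors        ≡⟨ map-∘ {g = möbius M} {f = act h ∘ point} T-vectors ⟩
  map (möbius M) (map (act h ∘ point) T-vectors)  ∎
  where
  open ≡-Reasoning
  W = Conjugation.word C
  T-vectors≢0 : All (_≢ 0²) T-vectors
  T-vectors≢0 = (λ ()) ∷ (λ ()) ∷ (λ ()) ∷ (λ ()) ∷ []

symmetry-preserves : ∀ {M} → Symmetry M → Preserves (M ·_)
symmetry-preserves {M} S v w (u , h , h↭vw) = unimodular , W ++ hM , (begin
  vertices (W ++ hM)                              ≡⟨ vertices-++ W hM ⟩
  map (act W) (vertices hM)                       ↭⟨ map⁺ (act W) tile ⟩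
  map (act W) (map (möbius M) (vertices []))      ≡⟨ conjugate-vertices determinant-unit C ⟩
  map (möbius M) (vertices h)                     ↭⟨ map⁺ (möbius M) h↭vw ⟩
  map (möbius M) (tetrahedron v w)                ≡⟨ möbius-tetrahedron M v w u ⟩
  tetrahedron (M · v) (M · w)                     ∎)
  where
  open Symmetry S
  open PermutationReasoning
  hM = proj₁ image-of-T
  tile = proj₂ image-of-T
  C = conjugation-word M conjugation h
  W = Conjugation.word C
  unimodular : Unimodular (M · v) (M · w)
  unimodular = subst IsUnit (sym (det-· M v w)) (IsUnit-* (determinant M) (det v w) determinant-unit u)

preserves-id : Preserves id
preserves-id _ _ fp = fp

preserves-∘ : ∀ {F G} → Preserves F → Preserves G → Preserves (F ∘ G)
preserves-∘ {F} {G} PF PG v w = PF (G v) (G w) ∘ PG v w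

preserves-≗ : ∀ {F G} → (∀ v → F v ≡ G v) → Preserves F → Preserves G
preserves-≗ {F} {G} F≗G PF v w = subst₂ FundamentalPair (F≗G v) (F≗G w) ∘ PF v w

preserves-⊙ : ∀ l → IsUnit l → Preserves (l ⊙_)
preserves-⊙ l l-unit v w (u , h , h↭vw) = unimodular , h , ↭-trans h↭vw (↭-reflexive (sym scaled))
  where
  open ℤσ-Solver using (solve; _:=_; _:*_; _:-_)
  l≢0 = IsUnit⇒≢0 l l-unit
  unimodular : Unimodular (l ⊙ v) (l ⊙ w)
  unimodular = subst IsUnit (sym (det-⊙ l v w)) (IsUnit-* (l *ℤσ l) (det v w) (IsUnit-* l l l-unit l-unit) u)
    where
    det-⊙ : ∀ l v w → det (l ⊙ v) (l ⊙ w) ≡ (l *ℤσ l) *ℤσ det v w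
    det-⊙ l (p , q) (r , s) = solve 5 (λ l p q r s → (l :* p) :* (l :* s) :- (l :* r) :* (l :* q) := (l :* l) :* (p :* s :- r :* q)) refl l p q r s
  scaled : tetrahedron (l ⊙ v) (l ⊙ w) ≡ tetrahedron v w
  scaled = cong₂ _∷_ (point-⊙ l v l≢0) (cong₂ _∷_ (point-⊙ l w l≢0)
          (cong₂ _∷_ (trans (cong point (sym (additive S v w))) (point-⊙ l (v ⊕ w) l≢0))
          (cong₂ _∷_ (trans (cong point (sym (trans (additive S v (σℤ ⊙ w)) (cong (l ⊙ v ⊕_) (homogeneous S σℤ w)))))
                            (point-⊙ l (v ⊕ σℤ ⊙ w) l≢0))
          refl)))
    where
    S = semilinear-scale l semilinear-id

fundamental-T : FundamentalPair (0ℤσ , 1ℤσ) (1ℤσ , 0ℤσ)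
fundamental-T = refl , [] , vertices-T

rotations : ℕ → ℤσ² → ℤσ²
rotations zero    v = v
rotations (suc k) v = rotation · rotations k v

preserves-rotations : ∀ k → Preserves (rotations k)
preserves-rotations zero    = preserves-id
preserves-rotations (suc k) = preserves-∘ (symmetry-preserves rotation-symmetry) (preserves-rotations k)

rotations-linear : ∀ k → Semilinear false (rotations k)
rotations-linear zero    = semilinear-id
rotations-linear (suc k) = semilinear-∘ (·-linear rotation) (rotations-linear k)

translation-+ : ∀ s t v → translation s · translation t · v ≡ translation (s +ℤσ t) · v
translation-+ s t (p , q) = cong₂ _,_
  (solve 4 (λ s t p q → con 1ℤσ :* (con 1ℤσ :* p :+ t :* q) :+ s :* (con 0ℤσ :* p :+ con 1ℤσ :* q) := con 1ℤσ :* p :+ (s :+ t) :* q) refl s t p q)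
  (solve 4 (λ s t p q → con 0ℤσ :* (con 1ℤσ :* p :+ t :* q) :+ con 1ℤσ :* (con 0ℤσ :* p :+ con 1ℤσ :* q) := con 0ℤσ :* p :+ con 1ℤσ :* q) refl s t p q)
  where open ℤσ-Solver using (solve; _:=_; _:+_; _:*_; con)

private
  preserves-translation-multiples : ∀ u → Preserves (translation u ·_) → Preserves (translation (negℤσ u) ·_) →
                                    ∀ k → Preserves (translation ((k + (+ 0) σ) *ℤσ u) ·_)
  preserves-translation-multiples u Tu T-u (+ zero)      = preserves-≗ (λ v → sym (translation-0 v)) preserves-id
    where
    open ℤσ-Solver using (solve; _:=_; _:+_; _:*_; con)
    translation-0 : ∀ v → translation (0ℤσ *ℤσ u) · v ≡ v
    translation-0 (p , q) = cong₂ _,_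
      (solve 3 (λ u p q → con 1ℤσ :* p :+ (con 0ℤσ :* u) :* q := p) refl u p q)
      (solve 2 (λ p q → con 0ℤσ :* p :+ con 1ℤσ :* q := q) refl p q)
  preserves-translation-multiples u Tu T-u (+ suc n)     =
    preserves-≗ (λ v → trans (translation-+ u _ v) (cong (λ t → translation t · v) (solve 2 (λ u x → u :+ x :* u := (con 1ℤσ :+ x) :* u) refl u ((+ n) + (+ 0) σ))))
                (preserves-∘ Tu (preserves-translation-multiples u Tu T-u (+ n)))
    where open ℤσ-Solver using (solve; _:=_; _:+_; _:*_; con)
  preserves-translation-multiples u Tu T-u -[1+ zero ]   =
    preserves-≗ (λ v → cong (λ t → translation t · v) (solve 1 (λ u → :- u := (:- con 1ℤσ) :* u) refl u)) T-u
    where open ℤσ-Solver using (solve; _:=_; _:*_; :-_; con)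
  preserves-translation-multiples u Tu T-u -[1+ suc n ] =
    preserves-≗ (λ v → trans (translation-+ (negℤσ u) _ v) (cong (λ t → translation t · v) (solve 2 (λ u x → (:- u) :+ x :* u := ((:- con 1ℤσ) :+ x) :* u) refl u (-[1+ n ] + (+ 0) σ))))
                (preserves-∘ T-u (preserves-translation-multiples u Tu T-u -[1+ n ]))
    where open ℤσ-Solver using (solve; _:=_; _:+_; _:*_; :-_; con)

-- D Tₜ D⁻¹ = T_{σt}, so T₋₁ = D³ T₁ D³, T_σ = D T₁ D⁵ and T₋σ = D⁴ T₁ D².
private
  preserves-conjugated-translation : ∀ t j k →
    rotations j (translation 1ℤσ · rotations k e₁) ≡ translation t · e₁ →
    rotations j (translation 1ℤσ · rotations k e₂) ≡ translation t · e₂ →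
    Preserves (translation t ·_)
  preserves-conjugated-translation t j k on-e₁ on-e₂ =
    preserves-≗ (semilinear-ext (semilinear-∘ (rotations-linear j) (semilinear-∘ (·-linear (translation 1ℤσ)) (rotations-linear k)))
                                (·-linear (translation t)) on-e₁ on-e₂)
                (preserves-∘ (preserves-rotations j) (preserves-∘ (symmetry-preserves translation-symmetry) (preserves-rotations k)))

  split : ∀ a b → (a + (+ 0) σ) *ℤσ 1ℤσ +ℤσ (b + (+ 0) σ) *ℤσ σℤ ≡ a + b σ
  split a b = cong₂ _+_σ (re-split a b) (im-split a b)
    where
    re-split : ∀ a b → (a * + 1 - + 0 * + 0) + (b * + 0 - + 0 * + 1) ≡ a
    re-split = solve-∀ ℤ-ring
    im-split : ∀ a b → (a * + 0 + + 0 * + 1 + + 0 * + 0) + (b * + 1 + + 0 * + 0 + + 0 * + 1) ≡ b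
    im-split = solve-∀ ℤ-ring

preserves-translation : ∀ t → Preserves (translation t ·_)
preserves-translation (a + b σ) =
  preserves-≗ (λ v → trans (translation-+ ((a + (+ 0) σ) *ℤσ 1ℤσ) ((b + (+ 0) σ) *ℤσ σℤ) v) (cong (λ t → translation t · v) (split a b)))
              (preserves-∘ (preserves-translation-multiples 1ℤσ T₁ T₋₁ a) (preserves-translation-multiples σℤ Tσ T₋σ b))
  where
  T₁  = symmetry-preserves translation-symmetry
  T₋₁ = preserves-conjugated-translation (negℤσ 1ℤσ) 3 3 refl refl
  Tσ  = preserves-conjugated-translation σℤ 1 5 refl refl
  T₋σ = preserves-conjugated-translation (negℤσ σℤ) 4 2 refl refl

fundamental-e₁e₂ : FundamentalPair e₁ e₂
fundamental-e₁e₂ = symmetry-preserves inversion-symmetry (0ℤσ , 1ℤσ) (1ℤσ , 0ℤσ) fundamental-T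

fundamental-diagonal : ∀ ε → IsUnit ε → FundamentalPair e₁ (0ℤσ , ε)
fundamental-diagonal ε ε-unit =
  subst₂ FundamentalPair (cong₂ _,_ (trans (cong (ε *ℤσ_) (sym ε̄≡σᵏ)) (IsUnit⇒*-conj≡1 ε ε-unit)) (*ℤσ-zeroʳ ε))
                         (cong₂ _,_ (*ℤσ-zeroʳ ε) (*ℤσ-identityʳ ε))
    (preserves-⊙ ε ε-unit (σ^ℕ k , 0ℤσ) e₂ (subst₂ FundamentalPair (rotations-e₁ k) (rotations-e₂ k)
      (preserves-rotations k e₁ e₂ fundamental-e₁e₂)))
  where
  open ℤσ-Solver using (solve; _:=_; _:+_; _:*_; con)
  k = proj₁ (IsUnit⇒σ^ℕ (conjℤσ ε) (IsUnit-conj ε ε-unit))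
  ε̄≡σᵏ = proj₂ (IsUnit⇒σ^ℕ (conjℤσ ε) (IsUnit-conj ε ε-unit))
  rotations-e₁ : ∀ k → rotations k e₁ ≡ (σ^ℕ k , 0ℤσ)
  rotations-e₁ zero    = refl
  rotations-e₁ (suc k) = trans (cong (rotation ·_) (rotations-e₁ k)) (cong₂ _,_
    (solve 1 (λ x → con σℤ :* x :+ con 0ℤσ :* con 0ℤσ := con σℤ :* x) refl (σ^ℕ k))
    (solve 1 (λ x → con 0ℤσ :* x :+ con 1ℤσ :* con 0ℤσ := con 0ℤσ) refl (σ^ℕ k)))
  rotations-e₂ : ∀ k → rotations k e₂ ≡ e₂
  rotations-e₂ zero    = refl
  rotations-e₂ (suc k) = cong (rotation ·_) (rotations-e₂ k)

fundamental-upper : ∀ a b d → Unimodular (a , 0ℤσ) (b , d) → FundamentalPair (a , 0ℤσ) (b , d)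
fundamental-upper a b d u =
  subst₂ FundamentalPair fix-first fix-second
    (preserves-translation t (a , 0ℤσ) (0ℤσ , d)
      (subst₂ FundamentalPair scale-first scale-second
        (preserves-⊙ a a-unit e₁ (0ℤσ , ε) (fundamental-diagonal ε ε-unit))))
  where
  open ℤσ-Solver using (solve; _:=_; _:+_; _:*_; _:-_; con)
  ad-unit : IsUnit (a *ℤσ d)
  ad-unit = subst IsUnit (solve 3 (λ a b d → a :* d :- b :* con 0ℤσ := a :* d) refl a b d) u
  a-unit = proj₁ (IsUnit-*⁻ a d ad-unit)
  d-unit = proj₂ (IsUnit-*⁻ a d ad-unit)
  ε = conjℤσ a *ℤσ d
  ε-unit = IsUnit-* (conjℤσ a) d (IsUnit-conj a a-unit) d-unit
  t = b *ℤσ conjℤσ d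
  scale-first : a ⊙ e₁ ≡ (a , 0ℤσ)
  scale-first = cong₂ _,_ (*ℤσ-identityʳ a) (*ℤσ-zeroʳ a)
  scale-second : a ⊙ (0ℤσ , ε) ≡ (0ℤσ , d)
  scale-second = cong₂ _,_ (*ℤσ-zeroʳ a)
    (trans (solve 3 (λ a ā d → a :* (ā :* d) := (a :* ā) :* d) refl a (conjℤσ a) d)
           (trans (cong (_*ℤσ d) (IsUnit⇒*-conj≡1 a a-unit)) (*ℤσ-identityˡ d)))
  fix-first : translation t · (a , 0ℤσ) ≡ (a , 0ℤσ)
  fix-first = cong₂ _,_ (solve 2 (λ t a → con 1ℤσ :* a :+ t :* con 0ℤσ := a) refl t a)
                        (solve 1 (λ a → con 0ℤσ :* a :+ con 1ℤσ :* con 0ℤσ := con 0ℤσ) refl a)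
  fix-second : translation t · (0ℤσ , d) ≡ (b , d)
  fix-second = cong₂ _,_
    (trans (solve 3 (λ b d̄ d → con 1ℤσ :* con 0ℤσ :+ (b :* d̄) :* d := b :* (d :* d̄)) refl b (conjℤσ d) d)
           (trans (cong (b *ℤσ_) (IsUnit⇒*-conj≡1 d d-unit)) (*ℤσ-identityʳ b)))
    (solve 1 (λ d → con 0ℤσ :* con 0ℤσ :+ con 1ℤσ :* d := d) refl d)

-- Euclid's algorithm: (a, c) = T_t J (c, a - t c) with N(a - t c) < N(c).
unimodular⇒fundamental : ∀ v w → Unimodular v w → FundamentalPair v w
unimodular⇒fundamental v w = descend v w (<-wellFounded (normℕ (proj₂ v)))
  where
  open ℤσ-Solver using (solve; _:=_; _:+_; _:*_; _:-_; con)
  descend : ∀ v w → Acc ℕ._<_ (normℕ (proj₂ v)) → Unimodular v w → FundamentalPair v w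
  descend (a , c) (b , d) (acc smaller) u with c ≟ℤσ 0ℤσ
  ... | yes refl = fundamental-upper a b d u
  ... | no  c≢0  = subst₂ FundamentalPair (undo a c) (undo b d)
    (preserves-translation t _ _ (symmetry-preserves inversion-symmetry _ _
      (descend (c , a -ℤσ t *ℤσ c) (d , b -ℤσ t *ℤσ d) (smaller (proj₂ (euclidean a c c≢0))) u′)))
    where
    t = proj₁ (euclidean a c c≢0)
    u′ : Unimodular (c , a -ℤσ t *ℤσ c) (d , b -ℤσ t *ℤσ d)
    u′ = subst IsUnit (sym (solve 5 (λ a b c d t → c :* (b :- t :* d) :- d :* (a :- t :* c) := (:- con 1ℤσ) :* (a :* d :- b :* c)) refl a b c d t))
               (IsUnit-* (negℤσ 1ℤσ) (det (a , c) (b , d)) refl u)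
      where open ℤσ-Solver using (:-_)
    undo : ∀ x y → translation t · inversion · (y , x -ℤσ t *ℤσ y) ≡ (x , y)
    undo x y = cong₂ _,_
      (solve 3 (λ t x y → con 1ℤσ :* (con 0ℤσ :* y :+ con 1ℤσ :* (x :- t :* y)) :+ t :* (con 1ℤσ :* y :+ con 0ℤσ :* (x :- t :* y)) := x) refl t x y)
      (solve 3 (λ t x y → con 0ℤσ :* (con 0ℤσ :* y :+ con 1ℤσ :* (x :- t :* y)) :+ con 1ℤσ :* (con 1ℤσ :* y :+ con 0ℤσ :* (x :- t :* y)) := y) refl t x y)

unimodular-swap : ∀ v w → Unimodular v w → Unimodular w v
unimodular-swap v@(p , q) w@(r , s) u = subst IsUnit
  (solve 4 (λ p q r s → (:- con 1ℤσ) :* (p :* s :- r :* q) := r :* q :- p :* s) refl p q r s)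
  (IsUnit-* (negℤσ 1ℤσ) (det v w) refl u)
  where open ℤσ-Solver using (solve; _:=_; _:*_; _:-_; :-_; con)

unimodular⇒irreducible : ∀ p q r s → Unimodular (p , q) (r , s) → Irreducible p q
unimodular⇒irreducible p q r s u = (λ { (refl , refl) → unimodular-≢0ˡ (p , q) (r , s) u refl }) , common-factor-unit
  where
  open ℤσ-Solver using (solve; _:=_; _:*_; _:-_)
  common-factor-unit : ∀ k → k ∣σ p → k ∣σ q → IsUnit k
  common-factor-unit k (m₁ , refl) (m₂ , refl) = proj₁ (IsUnit-*⁻ k (m₁ *ℤσ s -ℤσ r *ℤσ m₂) (subst IsUnit
    (solve 5 (λ k m₁ m₂ r s → (k :* m₁) :* s :- r :* (k :* m₂) := k :* (m₁ :* s :- r :* m₂)) refl k m₁ m₂ r s) u))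

statement-list≡tetrahedron : ∀ p q r s i →
  frac p q ∷ frac r s ∷ frac (p +ℤσ σ^ i *ℤσ r) (q +ℤσ σ^ i *ℤσ s)
    ∷ frac (p +ℤσ σ^ (i + + 1) *ℤσ r) (q +ℤσ σ^ (i + + 1) *ℤσ s) ∷ []
  ≡ tetrahedron (p , q) (σ^ i ⊙ (r , s))
statement-list≡tetrahedron p q r s i = cong₂ _∷_ refl (cong₂ _∷_ (sym (point-⊙ (σ^ i) (r , s) (IsUnit⇒≢0 (σ^ i) (IsUnit-σ^ i))))
  (cong₂ _∷_ refl (cong₂ _∷_ (cong₂ (λ x y → frac (p +ℤσ x) (q +ℤσ y)) (σ^suc-* r) (σ^suc-* s)) refl)))
  where
  σ^suc-* : ∀ x → σ^ (i + + 1) *ℤσ x ≡ σℤ *ℤσ (σ^ i *ℤσ x)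
  σ^suc-* x = trans (cong (_*ℤσ x) (σ^-suc i)) (*ℤσ-assoc σℤ (σ^ i) x)

EisensteinForm : List Point → Set
EisensteinForm L =
  Σ ℤσ λ p → Σ ℤσ λ q → Σ ℤσ λ r → Σ ℤσ λ s → Σ ℤ λ i →
    Irreducible p q × Irreducible r s × l²-is-one p q r s ×
    (L ↭ (frac p q ∷ frac r s
          ∷ frac (p +ℤσ σ^ i *ℤσ r) (q +ℤσ σ^ i *ℤσ s)
          ∷ frac (p +ℤσ σ^ (i + + 1) *ℤσ r) (q +ℤσ σ^ (i + + 1) *ℤσ s) ∷ []))

fundamental⇒form : ∀ L → Σ Word (λ h → L ↭ vertices h) → EisensteinForm L
fundamental⇒form L (h , L↭h) =
  let (p , q) , (r , s) , u , h↭ = vertices-tetrahedron h in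
  p , q , r , s , + 0 ,
  unimodular⇒irreducible p q r s u , unimodular⇒irreducible r s p q (unimodular-swap (p , q) (r , s) u) , u ,
  ↭-trans L↭h (↭-trans h↭ (↭-reflexive (sym (trans (statement-list≡tetrahedron p q r s (+ 0))
                                                  (cong (tetrahedron (p , q)) (⊙-identityˡ (r , s)))))))

form⇒fundamental : ∀ L → EisensteinForm L → Σ Word (λ h → L ↭ vertices h)
form⇒fundamental L (p , q , r , s , i , _ , _ , u , L↭) =
  let _ , h , h↭ = unimodular⇒fundamental (p , q) (σ^ i ⊙ (r , s)) (unimodular-⊙ʳ (σ^ i) (p , q) (r , s) (IsUnit-σ^ i) u) in
  h , ↭-trans L↭ (↭-trans (↭-reflexive (statement-list≡tetrahedron p q r s i)) (↭-sym h↭))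

proposition3p14 : (α β γ δ : Point) →
    (Σ Word (λ h → (α ∷ β ∷ γ ∷ δ ∷ []) ↭ vertices h))
    ⇔
    (Σ ℤσ λ p → Σ ℤσ λ q → Σ ℤσ λ r → Σ ℤσ λ s → Σ ℤ λ i →
       Irreducible p q × Irreducible r s × l²-is-one p q r s ×
       ((α ∷ β ∷ γ ∷ δ ∷ [])
         ↭ (frac p q ∷ frac r s
            ∷ frac (p +ℤσ σ^ i *ℤσ r) (q +ℤσ σ^ i *ℤσ s)
            ∷ frac (p +ℤσ σ^ (i + + 1) *ℤσ r) (q +ℤσ σ^ (i + + 1) *ℤσ s) ∷ [])))
proposition3p14 α β γ δ = mk⇔ (fundamental⇒form (α ∷ β ∷ γ ∷ δ ∷ [])) (form⇒fundamental (α ∷ β ∷ γ ∷ δ ∷ []))
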